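{- Let $n\ge 1$ and let $X=\sum_{1\le i<j\le n}\mathrm{wt}(i,j)\,I_{i,j}$ be a weighted inversion statistic on $S_n$ (with arbitrary fixed real weights $\mathrm{wt}(i,j)$). For a partition $\lambda=(1^{a_1},2^{a_2},\ldots,n^{a_n})\vdash n$, the expected value $\mathbb{E}_\lambda[X]$ of $X$ over the conjugacy class $C_\lambda$ depends only on $n$, $a_1$ and $a_2$; that is, if $\lambda,\mu\vdash n$ have the same number of parts equal to $1$ and the same number of parts equal to $2$, then $\mathbb{E}_\lambda[X]=\mathbb{E}_\mu[X]$.
   Context: $S_n$ is the symmetric group on $[n]=\{1,\dots,n\}$. For $\lambda\vdash n$, $C_\lambda$ is the conjugacy class of permutations of cycle type $\lambda$, and $\mathbb{E}_\lambda$ denotes expectation with respect to the uniform probability measure on $C_\lambda$. The notation $\lambda=(1^{a_1},2^{a_2},\ldots,n^{a_n})$ means $\lambda$ has exactly $a_i$ parts equal to $i$. For $1\le i<j\le n$, $I_{i,j}:S_n\to\{0,1\}$ is the indicator function of an inversion at $(i,j)$: $I_{i,j}(\omega)=1$ if $\omega(i)>\omega(j)$ and $0$ otherwise. A weighted inversion statistic on $S_n$ is any function of the form $\sum_{1\le i<j\le n}\mathrm{wt}(i,j)I_{i,j}$ with $\mathrm{wt}(i,j)\in\mathbb{R}$.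
   Formalization: The weights $\mathrm{wt}(i,j)$ of the inversion statistic are rational numbers rather than arbitrary reals. -}

module Defs where

open import Data.Nat as ℕ using (ℕ; zero; suc; _*_; _/_)
open import Data.Nat.Properties as ℕP using ()
open import Data.Fin using (Fin; toℕ; _<?_)
open import Data.Fin.Properties as FinP using (all?)
open import Data.List using (List; []; _∷_; [_]; map; concatMap; allFin; filter; length; foldr)
open import Data.Vec using (Vec; lookup; tabulate)
open import Data.Vec.Properties using (≡-dec)
open import Data.Integer using (+_)
open import Data.Rational as ℚ using (ℚ; 0ℚ)
open import Relation.Nullary using (Dec; does)
open import Relation.Nullary.Decidable using (_→-dec_; _×-dec_)
open import Relation.Binary.PropositionalEquality using (_≡_)
open import Data.Bool using (if_then_else_)

-- A permutation ω ∈ S_n is represented by its one-line notation: a vector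
-- v : Vec (Fin n) n with ω(i) = lookup v i, required to be injective
-- (hence bijective, Fin n being finite).

allVecs : (m k : ℕ) → List (Vec (Fin m) k)
allVecs m zero = [ Data.Vec.[] ]
allVecs m (suc k) = concatMap (λ x → map (x Data.Vec.∷_) (allVecs m k)) (allFin m)

IsPerm : {n : ℕ} → Vec (Fin n) n → Set
IsPerm {n} v = (i j : Fin n) → lookup v i ≡ lookup v j → i ≡ j

isPerm? : {n : ℕ} → (v : Vec (Fin n) n) → Dec (IsPerm v)
isPerm? v = all? λ i → all? λ j → (lookup v i FinP.≟ lookup v j) →-dec (i FinP.≟ j)

Sym : (n : ℕ) → List (Vec (Fin n) n)
Sym n = filter isPerm? (allVecs n n)

iter : {n : ℕ} → Vec (Fin n) n → ℕ → Fin n → Fin n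
iter v zero x = x
iter v (suc k) x = lookup v (iter v k x)

firstReturn : {n : ℕ} → Vec (Fin n) n → Fin n → (fuel k : ℕ) → ℕ
firstReturn v x zero k = k
firstReturn v x (suc f) k =
  if does (iter v k x FinP.≟ x) then k else firstReturn v x f (suc k)

-- length of the cycle of ω containing x (for a permutation, at most n)
cycLen : {n : ℕ} → Vec (Fin n) n → Fin n → ℕ
cycLen {n} v x = firstReturn v x n 1

-- cycle type as a multiplicity vector: entry i = number of cycles of length i+1
cycleType : {n : ℕ} → Vec (Fin n) n → Vec ℕ n
cycleType {n} v = tabulate λ i →
  length (filter (λ x → cycLen v x ℕ.≟ suc (toℕ i)) (allFin n)) / suc (toℕ i)

-- a partition λ = (1^{a_1}, …, n^{a_n}) ⊢ n, given by a : Vec ℕ n with a_{i+1} = lookup a i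
sumFin : {n : ℕ} → (Fin n → ℕ) → ℕ
sumFin {n} f = foldr ℕ._+_ 0 (map f (allFin n))

IsPartition : (n : ℕ) → Vec ℕ n → Set
IsPartition n a = sumFin (λ i → suc (toℕ i) * lookup a i) ≡ n

-- number of parts equal to k (0 if k = 0 or k > n)
mult : {n : ℕ} → Vec ℕ n → ℕ → ℕ
mult a k = sumFin (λ i → if does (suc (toℕ i) ℕ.≟ k) then lookup a i else 0)

Class : (n : ℕ) → Vec ℕ n → List (Vec (Fin n) n)
Class n a = filter (λ v → ≡-dec ℕ._≟_ (cycleType v) a) (Sym n)

sumℚ : List ℚ → ℚ
sumℚ = foldr ℚ._+_ 0ℚ

invStat : {n : ℕ} → (Fin n → Fin n → ℚ) → Vec (Fin n) n → ℚ
invStat {n} wt v = sumℚ (concatMap (λ i → map (λ j →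
  if does ((i <? j) ×-dec (lookup v j <? lookup v i)) then wt i j else 0ℚ)
  (allFin n)) (allFin n))

-- uniform average of a list (0 for the empty list)
average : List ℚ → ℚ
average [] = 0ℚ
average (x ∷ xs) = sumℚ (x ∷ xs) ℚ.* ((+ 1) ℚ./ suc (length xs))

expect : (n : ℕ) → Vec ℕ n → (Fin n → Fin n → ℚ) → ℚ
expect n a wt = average (map (invStat wt) (Class n a))

{-# OPTIONS --safe #-}
-- By linearity E_λ[X] = Σ_{i<j} wt(i,j) P_λ(ω(i) > ω(j)), and each such probability is a sum of the
-- probabilities P_λ(ω(i) = k, ω(j) = l) with i ≠ j.  Conjugation by a transposition preserves C_λ, so
-- P_λ(ω(i) = k, ω(j) = l) only depends on which of i, j, k, l coincide.  Summing it over the free point l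
-- gives a triangular linear system for these finitely many values: its coefficients are the positive
-- numbers n, n - 1, n - 2, n - 3 of points outside a pattern, and its only other inputs are the average
-- numbers of fixed points of ω and of ω², which on C_λ are a₁ and a₁ + 2a₂.  Hence every such probability
-- depends only on n, a₁ and a₂.  Comparing two classes this way needs both to be nonempty; a permutation
-- of any cycle type is obtained by rotating consecutive blocks of points.

module Submission where

open import Defs
open import Algebra.Bundles using (CommutativeMonoid; CommutativeSemiring; CommutativeRing)
import Algebra.Properties.CommutativeSemigroup as CommutativeSemigroupProperties
import Algebra.Properties.Semiring.Mult as SemiringMultiplication
open import Data.Bool using (true; false; if_then_else_)
open import Data.Empty using (⊥-elim)
open import Data.Fin as Fin using (Fin; toℕ; _<?_)
import Data.Fin.Properties as Finₚ
import Data.Fin.Permutation.Components as PC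
open import Data.List using (List; []; _∷_; map; concatMap; foldr; filter; _++_; length; allFin; replicate)
import Data.List.Properties as Listₚ
open import Data.List.Membership.Propositional using (_∈_; _∉_)
open import Data.List.Membership.Propositional.Properties using (∈-filter⁻)
open import Data.List.Relation.Unary.Any using (here; there)
open import Data.List.Relation.Unary.All using (All; []; _∷_)
open import Data.List.Relation.Unary.All.Properties using (All¬⇒¬Any)
open import Data.List.Relation.Unary.Unique.Propositional using (Unique)
open import Data.List.Relation.Unary.AllPairs using ([]; _∷_)
import Data.List.Membership.DecPropositional as DecMembership
open import Data.Nat as ℕ using (ℕ; zero; suc)
import Data.Nat.Properties as ℕₚ
import Data.Integer as ℤ
import Data.Integer.Properties as ℤₚ
open import Data.Rational as ℚ using (ℚ; 0ℚ; 1ℚ)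
import Data.Rational.Properties as ℚₚ
import Data.Rational.Unnormalised as ℚᵘ
import Data.Rational.Unnormalised.Properties as ℚᵘₚ
open import Data.Vec as Vec using (Vec; lookup)
import Data.Vec.Properties as Vecₚ
open import Function using (_∘_; id)
open import Relation.Binary.Definitions using (DecidableEquality)
open import Relation.Binary.PropositionalEquality
  using (_≡_; _≢_; refl; sym; trans; cong; cong₂; subst; subst₂; module ≡-Reasoning)
import Relation.Binary.Reasoning.Setoid as SetoidReasoning
open import Relation.Nullary using (Dec; yes; no; does; ¬_; ¬?)
open import Relation.Nullary.Decidable using (_×-dec_; dec-true; dec-false; does-⇔)
open import Function.Bundles using (mk⇔)
open import Relation.Unary using (Pred; Decidable)

module Sum {c ℓ} (M : CommutativeMonoid c ℓ) where

  open CommutativeMonoid M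
    renaming (refl to ≈-refl; sym to ≈-sym; trans to ≈-trans)
  open SetoidReasoning setoid

  ∑ : ∀ {a} {A : Set a} → List A → (A → Carrier) → Carrier
  ∑ xs f = foldr _∙_ ε (map f xs)

  syntax ∑ xs (λ x → e) = ∑[ x ∈ xs ] e

  module _ {a} {A : Set a} where

    ∑-cong : ∀ xs {f g : A → Carrier} → (∀ x → f x ≈ g x) → ∑ xs f ≈ ∑ xs g
    ∑-cong []       f≈g = ≈-refl
    ∑-cong (x ∷ xs) f≈g = ∙-cong (f≈g x) (∑-cong xs f≈g)

    ∑-cong-∈ : ∀ xs {f g : A → Carrier} → (∀ {x} → x ∈ xs → f x ≈ g x) → ∑ xs f ≈ ∑ xs g
    ∑-cong-∈ []       f≈g = ≈-refl
    ∑-cong-∈ (x ∷ xs) f≈g = ∙-cong (f≈g (here refl)) (∑-cong-∈ xs (f≈g ∘ there))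

    ∑-++ : ∀ xs ys (f : A → Carrier) → ∑ (xs ++ ys) f ≈ ∑ xs f ∙ ∑ ys f
    ∑-++ []       ys f = ≈-sym (identityˡ _)
    ∑-++ (x ∷ xs) ys f = begin
      f x ∙ ∑ (xs ++ ys) f      ≈⟨ ∙-congˡ (∑-++ xs ys f) ⟩
      f x ∙ (∑ xs f ∙ ∑ ys f)   ≈⟨ assoc _ _ _ ⟨
      (f x ∙ ∑ xs f) ∙ ∑ ys f   ∎

    ∑-zero : ∀ (xs : List A) → ∑ xs (λ _ → ε) ≈ ε
    ∑-zero []       = ≈-refl
    ∑-zero (x ∷ xs) = ≈-trans (identityˡ _) (∑-zero xs)

    ∑-distrib : ∀ xs (f g : A → Carrier) → ∑ xs (λ x → f x ∙ g x) ≈ ∑ xs f ∙ ∑ xs g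
    ∑-distrib []       f g = ≈-sym (identityˡ ε)
    ∑-distrib (x ∷ xs) f g = begin
      (f x ∙ g x) ∙ ∑ xs (λ x → f x ∙ g x)  ≈⟨ ∙-congˡ (∑-distrib xs f g) ⟩
      (f x ∙ g x) ∙ (∑ xs f ∙ ∑ xs g)       ≈⟨ interchange (f x) (g x) (∑ xs f) (∑ xs g) ⟩
      (f x ∙ ∑ xs f) ∙ (g x ∙ ∑ xs g)       ∎
      where open CommutativeSemigroupProperties commutativeSemigroup using (interchange)

  ∑-allFin-suc : ∀ n (f : Fin (suc n) → Carrier) → ∑ (allFin (suc n)) f ≡ f Fin.zero ∙ ∑ (allFin n) (f ∘ Fin.suc)
  ∑-allFin-suc n f = cong (λ xs → f Fin.zero ∙ foldr _∙_ ε xs)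
    (trans (Listₚ.map-tabulate Fin.suc f) (sym (Listₚ.map-tabulate id (f ∘ Fin.suc))))

  module _ {a b} {A : Set a} {B : Set b} where

    ∑-map : ∀ (g : A → B) xs (f : B → Carrier) → ∑ (map g xs) f ≡ ∑ xs (f ∘ g)
    ∑-map g xs f = cong (foldr _∙_ ε) (sym (Listₚ.map-∘ xs))

    ∑-concatMap : ∀ (g : A → List B) xs (f : B → Carrier) →
                  ∑ (concatMap g xs) f ≈ ∑ xs (λ x → ∑ (g x) f)
    ∑-concatMap g []       f = ≈-refl
    ∑-concatMap g (x ∷ xs) f = ≈-trans (∑-++ (g x) (concatMap g xs) f) (∙-congˡ (∑-concatMap g xs f))

    ∑-comm : ∀ xs ys (f : A → B → Carrier) → ∑ xs (λ x → ∑ ys (f x)) ≈ ∑ ys (λ y → ∑ xs (λ x → f x y))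
    ∑-comm []       ys f = ≈-sym (∑-zero ys)
    ∑-comm (x ∷ xs) ys f = ≈-trans (∙-congˡ (∑-comm xs ys f)) (≈-sym (∑-distrib ys (f x) _))

module SemiringSum {c ℓ} (R : CommutativeSemiring c ℓ) where

  open CommutativeSemiring R
    renaming (refl to ≈-refl; sym to ≈-sym; trans to ≈-trans)
  open Sum +-commutativeMonoid public
  open Sum ℕₚ.+-0-commutativeMonoid using () renaming (∑ to ∑ℕ)
  open SemiringMultiplication semiring using (_×_; ×-homo-+)
  open SetoidReasoning setoid

  module _ {a} {A : Set a} where

    ∑-*ˡ : ∀ xs x (f : A → Carrier) → ∑ xs (λ y → x * f y) ≈ x * ∑ xs f
    ∑-*ˡ []       x f = ≈-sym (zeroʳ x)
    ∑-*ˡ (y ∷ xs) x f = ≈-trans (+-congˡ (∑-*ˡ xs x f)) (≈-sym (distribˡ x (f y) _))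

    ∑-*ʳ : ∀ xs x (f : A → Carrier) → ∑ xs (λ y → f y * x) ≈ ∑ xs f * x
    ∑-*ʳ []       x f = ≈-sym (zeroˡ x)
    ∑-*ʳ (y ∷ xs) x f = ≈-trans (+-congˡ (∑-*ʳ xs x f)) (≈-sym (distribʳ x (f y) _))

    ∑ℕ-× : ∀ xs (m : A → ℕ) x → ∑ℕ xs m × x ≈ ∑ xs (λ y → m y × x)
    ∑ℕ-× []       m x = ≈-refl
    ∑ℕ-× (y ∷ xs) m x = ≈-trans (×-homo-+ x (m y) _) (+-congˡ (∑ℕ-× xs m x))

module Scaling {c ℓ} (R : CommutativeSemiring c ℓ) where

  open CommutativeSemiring R
    renaming (refl to ≈-refl; sym to ≈-sym; trans to ≈-trans; reflexive to ≈-reflexive)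
  open SemiringMultiplication semiring using (_×_; ×-congʳ; ×-assoc-*; ×1-homo-*)
  open CommutativeSemigroupProperties *-commutativeSemigroup using (interchange; xy∙z≈xz∙y)
  open SetoidReasoning setoid

  ×-ratio : ∀ {m m′ c c′ : ℕ} x {q q′} → m ℕ.* c′ ≡ m′ ℕ.* c →
            (c × 1#) * q ≈ 1# → (c′ × 1#) * q′ ≈ 1# → (m × x) * q ≈ (m′ × x) * q′
  ×-ratio {m} {m′} {c} {c′} x {q} {q′} mc′≡m′c cq≈1 c′q′≈1 = begin
    (m × x) * q                     ≈⟨ *-congʳ (×-as-* m) ⟨
    (M * x) * q                     ≈⟨ xy∙z≈xz∙y M x q ⟩
    (M * q) * x                     ≈⟨ *-congʳ ratio ⟩
    (M′ * q′) * x                   ≈⟨ xy∙z≈xz∙y M′ q′ x ⟩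
    (M′ * x) * q′                   ≈⟨ *-congʳ (×-as-* m′) ⟩
    (m′ × x) * q′                   ∎
    where
    M M′ C C′ : Carrier
    M = m × 1#
    M′ = m′ × 1#
    C = c × 1#
    C′ = c′ × 1#
    ×-as-* : ∀ k → (k × 1#) * x ≈ k × x
    ×-as-* k = ≈-trans (×-assoc-* k 1# x) (×-congʳ k (*-identityˡ x))
    MC′≈M′C : M * C′ ≈ M′ * C
    MC′≈M′C = ≈-trans (≈-sym (×1-homo-* m c′)) (≈-trans (≈-reflexive (cong (_× 1#) mc′≡m′c)) (×1-homo-* m′ c))
    ratio : M * q ≈ M′ * q′
    ratio = begin
      M * q                 ≈⟨ *-identityʳ (M * q) ⟨
      (M * q) * 1#          ≈⟨ *-congˡ c′q′≈1 ⟨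
      (M * q) * (C′ * q′)   ≈⟨ interchange M q C′ q′ ⟩
      (M * C′) * (q * q′)   ≈⟨ *-congʳ MC′≈M′C ⟩
      (M′ * C) * (q * q′)   ≈⟨ *-congˡ (*-comm q q′) ⟩
      (M′ * C) * (q′ * q)   ≈⟨ interchange M′ C q′ q ⟩
      (M′ * q′) * (C * q)   ≈⟨ *-congˡ cq≈1 ⟩
      (M′ * q′) * 1#        ≈⟨ *-identityʳ (M′ * q′) ⟩
      M′ * q′               ∎

open import Data.Nat using (_+_; _*_; _∸_; _/_; _≤_; _<_; s≤s; z≤n)
open import Data.Nat.GeneralisedArithmetic using (fold; fold-+)
open import Data.Nat.Divisibility using (_∣_; divides; ∣m∣n⇒∣m+n)
open import Data.Nat.DivMod using (n/1≡n; m*n/n≡m; m*[n/m]≡n)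
open import Data.Product using (_×_; _,_; proj₁; proj₂; ∃-syntax)
open import Data.Sum using (_⊎_; inj₁; inj₂)
open SemiringSum ℕₚ.+-*-commutativeSemiring
  using (∑; ∑-cong; ∑-cong-∈; ∑-zero; ∑-distrib; ∑-map; ∑-concatMap; ∑-allFin-suc; ∑-comm; ∑-*ˡ; ∑-*ʳ)

module _ {p a} {P : Set p} {A : Set a} (P? : Dec P) {u w : A} where

  if-does-yes : P → (if does P? then u else w) ≡ u
  if-does-yes p = cong (if_then u else w) (dec-true P? p)

  if-does-no : ¬ P → (if does P? then u else w) ≡ w
  if-does-no ¬p = cong (if_then u else w) (dec-false P? ¬p)

𝟙[_] : ∀ {p} {P : Set p} → Dec P → ℕ
𝟙[ P? ] = if does P? then 1 else 0

module _ {p} {P : Set p} where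

  𝟙-yes : (P? : Dec P) → P → 𝟙[ P? ] ≡ 1
  𝟙-yes P? = if-does-yes P?

  𝟙-no : (P? : Dec P) → ¬ P → 𝟙[ P? ] ≡ 0
  𝟙-no P? = if-does-no P?

  𝟙-idem : (P? : Dec P) → 𝟙[ P? ] * 𝟙[ P? ] ≡ 𝟙[ P? ]
  𝟙-idem (yes _) = refl
  𝟙-idem (no _)  = refl

  𝟙-guard : (P? : Dec P) → ∀ {x y} → (P → x ≡ y) → 𝟙[ P? ] * x ≡ 𝟙[ P? ] * y
  𝟙-guard (yes p) x≡y = cong (1 *_) (x≡y p)
  𝟙-guard (no _)  x≡y = refl

  module _ {q} {Q : Set q} where

    𝟙-⇔ : (P? : Dec P) (Q? : Dec Q) → (P → Q) → (Q → P) → 𝟙[ P? ] ≡ 𝟙[ Q? ]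
    𝟙-⇔ P? Q? P→Q Q→P = cong (if_then 1 else 0) (does-⇔ (mk⇔ P→Q Q→P) P? Q?)

    𝟙-× : (P? : Dec P) (Q? : Dec Q) → 𝟙[ P? ×-dec Q? ] ≡ 𝟙[ P? ] * 𝟙[ Q? ]
    𝟙-× (yes _) (yes _) = refl
    𝟙-× (yes _) (no _)  = refl
    𝟙-× (no _)  _       = refl

module _ {a} {A : Set a} where

  ∑-filter : ∀ {p} {P : Pred A p} (P? : Decidable P) xs (f : A → ℕ) →
             ∑ (filter P? xs) f ≡ ∑ xs (λ x → 𝟙[ P? x ] * f x)
  ∑-filter P? []       f = refl
  ∑-filter P? (x ∷ xs) f with does (P? x)
  ... | true  = cong₂ _+_ (sym (ℕₚ.+-identityʳ (f x))) (∑-filter P? xs f)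
  ... | false = ∑-filter P? xs f

  length≡∑1 : ∀ (xs : List A) → length xs ≡ ∑ xs (λ _ → 1)
  length≡∑1 []       = refl
  length≡∑1 (x ∷ xs) = cong suc (length≡∑1 xs)

  ∑-mono-≤ : ∀ xs {f g : A → ℕ} → (∀ x → f x ≤ g x) → ∑ xs f ≤ ∑ xs g
  ∑-mono-≤ []       f≤g = z≤n
  ∑-mono-≤ (x ∷ xs) f≤g = ℕₚ.+-mono-≤ (f≤g x) (∑-mono-≤ xs f≤g)

length-filter : ∀ {a p} {A : Set a} {P : Pred A p} (P? : Decidable P) xs →
                length (filter P? xs) ≡ ∑[ x ∈ xs ] 𝟙[ P? x ]
length-filter P? xs = trans (length≡∑1 (filter P? xs))
  (trans (∑-filter P? xs (λ _ → 1)) (∑-cong xs (λ x → ℕₚ.*-identityʳ 𝟙[ P? x ])))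

module Enumeration {a} {A : Set a} (_≟_ : DecidableEquality A) where

  Enumerates : List A → Set a
  Enumerates xs = ∀ z → ∑[ x ∈ xs ] 𝟙[ x ≟ z ] ≡ 1

  module Enumerated (xs : List A) (enum : Enumerates xs) where

    ∑-sift : ∀ z (h : A → ℕ) → ∑[ x ∈ xs ] (𝟙[ x ≟ z ] * h x) ≡ h z
    ∑-sift z h = begin
      ∑[ x ∈ xs ] (𝟙[ x ≟ z ] * h x)  ≡⟨ ∑-cong xs (λ x → 𝟙-guard (x ≟ z) (cong h)) ⟩
      ∑[ x ∈ xs ] (𝟙[ x ≟ z ] * h z)  ≡⟨ ∑-*ʳ xs (h z) _ ⟩
      ∑[ x ∈ xs ] 𝟙[ x ≟ z ] * h z    ≡⟨ cong (_* h z) (enum z) ⟩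
      1 * h z                          ≡⟨ ℕₚ.*-identityˡ (h z) ⟩
      h z                              ∎
      where open ≡-Reasoning

    occurs-once : ∀ z → ∑[ x ∈ xs ] 𝟙[ z ≟ x ] ≡ 1
    occurs-once z = trans (∑-cong xs (λ x → 𝟙-⇔ (z ≟ x) (x ≟ z) sym sym)) (enum z)

    ∑-sift′ : ∀ z (h : A → ℕ) → ∑[ x ∈ xs ] (𝟙[ z ≟ x ] * h x) ≡ h z
    ∑-sift′ z h = trans (∑-cong xs (λ x → cong (_* h x) (𝟙-⇔ (z ≟ x) (x ≟ z) sym sym))) (∑-sift z h)

    ∑-reindex : (φ : A → A) → (∀ x → φ (φ x) ≡ x) → (h : A → ℕ) → ∑ xs (h ∘ φ) ≡ ∑ xs h
    ∑-reindex φ φ∘φ≡id h = begin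
      ∑[ x ∈ xs ] h (φ x)                           ≡⟨ ∑-cong xs (λ x → ∑-sift (φ x) h) ⟨
      ∑[ x ∈ xs ] ∑[ y ∈ xs ] (𝟙[ y ≟ φ x ] * h y)  ≡⟨ ∑-comm xs xs _ ⟩
      ∑[ y ∈ xs ] ∑[ x ∈ xs ] (𝟙[ y ≟ φ x ] * h y)  ≡⟨ ∑-cong xs (λ y → ∑-cong xs (λ x → cong (_* h y) (𝟙-flip y x))) ⟩
      ∑[ y ∈ xs ] ∑[ x ∈ xs ] (𝟙[ x ≟ φ y ] * h y)  ≡⟨ ∑-cong xs (λ y → ∑-*ʳ xs (h y) _) ⟩
      ∑[ y ∈ xs ] (∑[ x ∈ xs ] 𝟙[ x ≟ φ y ] * h y)  ≡⟨ ∑-cong xs (λ y → cong (_* h y) (enum (φ y))) ⟩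
      ∑[ y ∈ xs ] (1 * h y)                         ≡⟨ ∑-cong xs (λ y → ℕₚ.*-identityˡ (h y)) ⟩
      ∑ xs h                                        ∎
      where
      open ≡-Reasoning
      swap : ∀ x y → x ≡ φ y → y ≡ φ x
      swap x y x≡φy = trans (sym (φ∘φ≡id y)) (cong φ (sym x≡φy))
      𝟙-flip : ∀ y x → 𝟙[ y ≟ φ x ] ≡ 𝟙[ x ≟ φ y ]
      𝟙-flip y x = 𝟙-⇔ (y ≟ φ x) (x ≟ φ y) (swap y x) (swap x y)

    ∑-remove : ∀ z (h : A → ℕ) → ∑ xs h ≡ h z + ∑[ x ∈ xs ] (𝟙[ ¬? (x ≟ z) ] * h x)
    ∑-remove z h = begin
      ∑ xs h                                      ≡⟨ ∑-cong xs split ⟩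
      ∑[ x ∈ xs ] (𝟙[ x ≟ z ] * h x + rest x)     ≡⟨ ∑-distrib xs _ rest ⟩
      ∑[ x ∈ xs ] (𝟙[ x ≟ z ] * h x) + ∑ xs rest  ≡⟨ cong (_+ ∑ xs rest) (∑-sift z h) ⟩
      h z + ∑ xs rest                             ∎
      where
      open ≡-Reasoning
      rest : A → ℕ
      rest x = 𝟙[ ¬? (x ≟ z) ] * h x
      split : ∀ x → h x ≡ 𝟙[ x ≟ z ] * h x + rest x
      split x with x ≟ z
      ... | yes _ = sym (trans (ℕₚ.+-identityʳ _) (ℕₚ.+-identityʳ (h x)))
      ... | no _  = sym (ℕₚ.+-identityʳ (h x))

    ∑-term-≤ : ∀ z (h : A → ℕ) → h z ≤ ∑ xs h
    ∑-term-≤ z h = subst (_≤ ∑ xs h) (∑-sift z h) (∑-mono-≤ xs term≤)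
      where
      term≤ : ∀ x → 𝟙[ x ≟ z ] * h x ≤ h x
      term≤ x with does (x ≟ z)
      ... | true  = ℕₚ.≤-reflexive (ℕₚ.+-identityʳ (h x))
      ... | false = z≤n

module FinEnumeration {n : ℕ} = Enumeration (Finₚ._≟_ {n})
module VecEnumeration {m k : ℕ} = Enumeration (Vecₚ.≡-dec {n = k} (Finₚ._≟_ {m}))

allFin-enumerates : ∀ n → FinEnumeration.Enumerates (allFin n)
allFin-enumerates (suc n) Fin.zero =
  trans (∑-allFin-suc n (λ x → 𝟙[ x Finₚ.≟ Fin.zero ])) (cong suc (∑-zero (allFin n)))
allFin-enumerates (suc n) (Fin.suc z) =
  trans (∑-allFin-suc n (λ x → 𝟙[ x Finₚ.≟ Fin.suc z ]))
        (trans (∑-cong (allFin n) (λ x → 𝟙-⇔ (Fin.suc x Finₚ.≟ Fin.suc z) (x Finₚ.≟ z) Finₚ.suc-injective (cong Fin.suc)))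
               (allFin-enumerates n z))

module AllFin {n : ℕ} = FinEnumeration.Enumerated (allFin n) (allFin-enumerates n)

allVecs-enumerates : ∀ m k → VecEnumeration.Enumerates (allVecs m k)
allVecs-enumerates m zero    Vec.[]         = refl
allVecs-enumerates m (suc k) (z Vec.∷ zs) = begin
  ∑[ w ∈ allVecs m (suc k) ] 𝟙[ w ≟ᵛ (z Vec.∷ zs) ]
    ≡⟨ ∑-concatMap (λ x → map (x Vec.∷_) (allVecs m k)) (allFin m) (λ w → 𝟙[ w ≟ᵛ (z Vec.∷ zs) ]) ⟩
  ∑[ x ∈ allFin m ] ∑[ w ∈ map (x Vec.∷_) (allVecs m k) ] 𝟙[ w ≟ᵛ (z Vec.∷ zs) ]
    ≡⟨ ∑-cong (allFin m) (λ x → ∑-map (x Vec.∷_) (allVecs m k) _) ⟩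
  ∑[ x ∈ allFin m ] ∑[ w ∈ allVecs m k ] 𝟙[ (x Vec.∷ w) ≟ᵛ (z Vec.∷ zs) ]
    ≡⟨ ∑-cong (allFin m) (λ x → ∑-cong (allVecs m k) (λ w → 𝟙-∷ x w)) ⟩
  ∑[ x ∈ allFin m ] ∑[ w ∈ allVecs m k ] (𝟙[ x Finₚ.≟ z ] * 𝟙[ w ≟ᵛ zs ])
    ≡⟨ ∑-cong (allFin m) (λ x → ∑-*ˡ (allVecs m k) 𝟙[ x Finₚ.≟ z ] _) ⟩
  ∑[ x ∈ allFin m ] (𝟙[ x Finₚ.≟ z ] * ∑[ w ∈ allVecs m k ] 𝟙[ w ≟ᵛ zs ])
    ≡⟨ AllFin.∑-sift z (λ _ → ∑[ w ∈ allVecs m k ] 𝟙[ w ≟ᵛ zs ]) ⟩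
  ∑[ w ∈ allVecs m k ] 𝟙[ w ≟ᵛ zs ]
    ≡⟨ allVecs-enumerates m k zs ⟩
  1 ∎
  where
  open ≡-Reasoning
  _≟ᵛ_ : ∀ {k} → DecidableEquality (Vec (Fin m) k)
  _≟ᵛ_ = Vecₚ.≡-dec Finₚ._≟_
  𝟙-∷ : ∀ x w → 𝟙[ (x Vec.∷ w) ≟ᵛ (z Vec.∷ zs) ] ≡ 𝟙[ x Finₚ.≟ z ] * 𝟙[ w ≟ᵛ zs ]
  𝟙-∷ x w = trans (𝟙-⇔ ((x Vec.∷ w) ≟ᵛ (z Vec.∷ zs)) ((x Finₚ.≟ z) ×-dec (w ≟ᵛ zs))
                       Vecₚ.∷-injective (λ (x≡z , w≡zs) → cong₂ Vec._∷_ x≡z w≡zs))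
                  (𝟙-× (x Finₚ.≟ z) (w ≟ᵛ zs))

module AllVecs {m k : ℕ} = VecEnumeration.Enumerated (allVecs m k) (allVecs-enumerates m k)

module _ {n : ℕ} where

  open DecMembership (Finₚ._≟_ {n}) using (_∉?_)

  #outside : List (Fin n) → ℕ
  #outside zs = ∑[ y ∈ allFin n ] 𝟙[ y ∉? zs ]

  #outside-pos : ∀ {zs l} → l ∉ zs → 1 ≤ #outside zs
  #outside-pos {zs} {l} l∉zs = subst (_≤ #outside zs) (𝟙-yes (l ∉? zs) l∉zs)
    (AllFin.∑-term-≤ l (λ y → 𝟙[ y ∉? zs ]))

  ∑-split : ∀ {zs} → Unique zs → (h : Fin n → ℕ) →
            ∑ (allFin n) h ≡ ∑ zs h + ∑[ y ∈ allFin n ] (𝟙[ y ∉? zs ] * h y)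
  ∑-split [] h = ∑-cong (allFin n) (λ y → sym (ℕₚ.+-identityʳ (h y)))
  ∑-split {z ∷ zs} (z≢zs ∷ zs-unique) h = begin
    ∑ (allFin n) h
      ≡⟨ ∑-split zs-unique h ⟩
    ∑ zs h + ∑ (allFin n) (rest zs)
      ≡⟨ cong (∑ zs h +_) (AllFin.∑-remove z (rest zs)) ⟩
    ∑ zs h + (rest zs z + ∑ (allFin n) rest′)
      ≡⟨ cong₂ (λ u w → ∑ zs h + (u + w)) rest-z (∑-cong (allFin n) rest′≡) ⟩
    ∑ zs h + (h z + ∑ (allFin n) (rest (z ∷ zs)))
      ≡⟨ ℕₚ.+-assoc (∑ zs h) (h z) _ ⟨
    ∑ zs h + h z + ∑ (allFin n) (rest (z ∷ zs))
      ≡⟨ cong (_+ ∑ (allFin n) (rest (z ∷ zs))) (ℕₚ.+-comm (∑ zs h) (h z)) ⟩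
    h z + ∑ zs h + ∑ (allFin n) (rest (z ∷ zs)) ∎
    where
    open ≡-Reasoning
    rest : List (Fin n) → Fin n → ℕ
    rest ws y = 𝟙[ y ∉? ws ] * h y
    rest′ : Fin n → ℕ
    rest′ y = 𝟙[ ¬? (y Finₚ.≟ z) ] * rest zs y
    rest-z : rest zs z ≡ h z
    rest-z = trans (cong (_* h z) (𝟙-yes (z ∉? zs) (All¬⇒¬Any z≢zs))) (ℕₚ.*-identityˡ (h z))
    𝟙-∉-∷ : ∀ y → 𝟙[ ¬? (y Finₚ.≟ z) ] * 𝟙[ y ∉? zs ] ≡ 𝟙[ y ∉? z ∷ zs ]
    𝟙-∉-∷ y = trans (sym (𝟙-× (¬? (y Finₚ.≟ z)) (y ∉? zs)))
      (𝟙-⇔ (¬? (y Finₚ.≟ z) ×-dec (y ∉? zs)) (y ∉? z ∷ zs)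
           (λ (y≢z , y∉zs) → λ { (here y≡z) → y≢z y≡z ; (there y∈zs) → y∉zs y∈zs })
           (λ y∉ → (y∉ ∘ here) , (y∉ ∘ there)))
    rest′≡ : ∀ y → rest′ y ≡ rest (z ∷ zs) y
    rest′≡ y = trans (sym (ℕₚ.*-assoc 𝟙[ ¬? (y Finₚ.≟ z) ] 𝟙[ y ∉? zs ] (h y))) (cong (_* h y) (𝟙-∉-∷ y))

  ∑-split-const : ∀ {zs} → Unique zs → ∀ {h : Fin n → ℕ} {m} → (∀ y → y ∉ zs → h y ≡ m) →
                  ∑ (allFin n) h ≡ ∑ zs h + #outside zs * m
  ∑-split-const {zs} zs-unique {h} {m} h≡m = trans (∑-split zs-unique h) (cong (∑ zs h +_) (begin
    ∑[ y ∈ allFin n ] (𝟙[ y ∉? zs ] * h y)  ≡⟨ ∑-cong (allFin n) (λ y → 𝟙-guard (y ∉? zs) (h≡m y)) ⟩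
    ∑[ y ∈ allFin n ] (𝟙[ y ∉? zs ] * m)    ≡⟨ ∑-*ʳ (allFin n) m _ ⟩
    #outside zs * m                         ∎))
    where open ≡-Reasoning

module _ {n : ℕ} where

  open PC using (transpose)

  transpose-matchˡ : ∀ (i j : Fin n) → transpose i j i ≡ j
  transpose-matchˡ i j with i Finₚ.≟ i
  ... | yes _   = refl
  ... | no i≢i = ⊥-elim (i≢i refl)

  transpose-other : ∀ {i j k : Fin n} → k ≢ i → k ≢ j → transpose i j k ≡ k
  transpose-other {i} {j} {k} k≢i k≢j with k Finₚ.≟ i
  ... | yes k≡i = ⊥-elim (k≢i k≡i)
  ... | no _ with k Finₚ.≟ j
  ...   | yes k≡j = ⊥-elim (k≢j k≡j)
  ...   | no _    = refl

  transpose-involutive : ∀ (i j k : Fin n) → transpose i j (transpose i j k) ≡ k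
  transpose-involutive i j k with k Finₚ.≟ i
  ... | yes refl = transpose-matchʳ
    where
    transpose-matchʳ : transpose k j j ≡ k
    transpose-matchʳ with j Finₚ.≟ k
    ... | yes j≡k = j≡k
    ... | no _ with j Finₚ.≟ j
    ...   | yes _   = refl
    ...   | no j≢j = ⊥-elim (j≢j refl)
  ... | no k≢i with k Finₚ.≟ j
  ...   | yes refl = transpose-matchˡ i k
  ...   | no k≢j   = transpose-other k≢i k≢j

  transpose-outside : ∀ {zs : List (Fin n)} {y l z} → y ∉ zs → l ∉ zs → z ∈ zs → transpose y l z ≡ z
  transpose-outside {zs} y∉zs l∉zs z∈zs =
    transpose-other (λ z≡y → y∉zs (subst (_∈ zs) z≡y z∈zs)) (λ z≡l → l∉zs (subst (_∈ zs) z≡l z∈zs))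

onCycles : ∀ {n} → Vec (Fin n) n → ℕ → ℕ
onCycles {n} v c = length (filter (λ x → cycLen v x ℕ.≟ c) (allFin n))

-- The conjugate t v t⁻¹ when t is an involution.
conj : ∀ {n} → (Fin n → Fin n) → Vec (Fin n) n → Vec (Fin n) n
conj t v = Vec.tabulate (t ∘ lookup v ∘ t)

module Conjugation {n : ℕ} (t : Fin n → Fin n) (t-involutive : ∀ x → t (t x) ≡ x) where

  t-injective : ∀ {x y} → t x ≡ t y → x ≡ y
  t-injective {x} {y} tx≡ty = trans (sym (t-involutive x)) (trans (cong t tx≡ty) (t-involutive y))

  lookup-conj : ∀ v x → lookup (conj t v) (t x) ≡ t (lookup v x)
  lookup-conj v x = trans (Vecₚ.lookup∘tabulate _ (t x)) (cong (t ∘ lookup v) (t-involutive x))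

  conj-involutive : ∀ v → conj t (conj t v) ≡ v
  conj-involutive v = trans (Vecₚ.tabulate-cong (λ x → trans (cong t (lookup-conj v x)) (t-involutive _)))
                            (Vecₚ.tabulate∘lookup v)

  conj-isPerm : ∀ v → IsPerm v → IsPerm (conj t v)
  conj-isPerm v v-inj i j vi≡vj = t-injective (v-inj (t i) (t j) (t-injective
    (trans (sym (Vecₚ.lookup∘tabulate _ i)) (trans vi≡vj (Vecₚ.lookup∘tabulate _ j)))))

  iter-conj : ∀ v k x → iter (conj t v) k (t x) ≡ t (iter v k x)
  iter-conj v zero    x = refl
  iter-conj v (suc k) x = trans (cong (lookup (conj t v)) (iter-conj v k x)) (lookup-conj v (iter v k x))

  firstReturn-conj : ∀ v x fuel k → firstReturn (conj t v) (t x) fuel k ≡ firstReturn v x fuel k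
  firstReturn-conj v x zero       k = refl
  firstReturn-conj v x (suc fuel) k
    rewrite iter-conj v k x
          | does-⇔ (mk⇔ t-injective (cong t)) (t (iter v k x) Finₚ.≟ t x) (iter v k x Finₚ.≟ x)
          | firstReturn-conj v x fuel (suc k) = refl

  onCycles-conj : ∀ v c → onCycles (conj t v) c ≡ onCycles v c
  onCycles-conj v c = begin
    onCycles (conj t v) c
      ≡⟨ length-filter _ (allFin n) ⟩
    ∑[ x ∈ allFin n ] 𝟙[ cycLen (conj t v) x ℕ.≟ c ]
      ≡⟨ AllFin.∑-reindex t t-involutive (λ x → 𝟙[ cycLen (conj t v) x ℕ.≟ c ]) ⟨
    ∑[ x ∈ allFin n ] 𝟙[ cycLen (conj t v) (t x) ℕ.≟ c ]
      ≡⟨ ∑-cong (allFin n) (λ x → cong (λ ℓ → 𝟙[ ℓ ℕ.≟ c ]) (firstReturn-conj v x n 1)) ⟩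
    ∑[ x ∈ allFin n ] 𝟙[ cycLen v x ℕ.≟ c ]
      ≡⟨ length-filter _ (allFin n) ⟨
    onCycles v c ∎
    where open ≡-Reasoning

  cycleType-conj : ∀ v → cycleType (conj t v) ≡ cycleType v
  cycleType-conj v = Vecₚ.tabulate-cong (λ i → cong (_/ suc (toℕ i)) (onCycles-conj v (suc (toℕ i))))

fixedPoints : ∀ {n} → Vec (Fin n) n → ℕ
fixedPoints {n} v = ∑[ x ∈ allFin n ] 𝟙[ lookup v x Finₚ.≟ x ]

squareFixedPoints : ∀ {n} → Vec (Fin n) n → ℕ
squareFixedPoints {n} v = ∑[ x ∈ allFin n ] 𝟙[ lookup v (lookup v x) Finₚ.≟ x ]

firstReturn-≥ : ∀ {n} (v : Vec (Fin n) n) x fuel k → k ≤ firstReturn v x fuel k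
firstReturn-≥ v x zero       k = ℕₚ.≤-refl
firstReturn-≥ v x (suc fuel) k with does (iter v k x Finₚ.≟ x)
... | true  = ℕₚ.≤-refl
... | false = ℕₚ.≤-trans (ℕₚ.n≤1+n k) (firstReturn-≥ v x fuel (suc k))

𝟙-cycLen≡1 : ∀ {n} (v : Vec (Fin (suc n)) (suc n)) x → 𝟙[ cycLen v x ℕ.≟ 1 ] ≡ 𝟙[ lookup v x Finₚ.≟ x ]
𝟙-cycLen≡1 {n} v x with lookup v x Finₚ.≟ x
... | yes _ = refl
... | no _  = 𝟙-no (firstReturn v x n 2 ℕ.≟ 1) (λ eq → ℕₚ.1+n≰n (subst (2 ≤_) eq (firstReturn-≥ v x n 2)))

𝟙-cycLen≡2 : ∀ {n} (v : Vec (Fin (suc n)) (suc n)) x →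
             𝟙[ cycLen v x ℕ.≟ 2 ] ≡ 𝟙[ ¬? (lookup v x Finₚ.≟ x) ×-dec (lookup v (lookup v x) Finₚ.≟ x) ]
𝟙-cycLen≡2 v x with lookup v x Finₚ.≟ x
... | yes _ = refl
𝟙-cycLen≡2 {zero} v Fin.zero | no vx≢x with lookup v Fin.zero
... | Fin.zero = ⊥-elim (vx≢x refl)
𝟙-cycLen≡2 {suc n} v x | no _ with lookup v (lookup v x) Finₚ.≟ x
... | yes _ = refl
... | no _  = 𝟙-no (firstReturn v x n 3 ℕ.≟ 2) (λ eq → ℕₚ.1+n≰n (subst (3 ≤_) eq (firstReturn-≥ v x n 3)))

lookup-cycleType : ∀ {n} (v : Vec (Fin n) n) i → lookup (cycleType v) i ≡ onCycles v (suc (toℕ i)) / suc (toℕ i)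
lookup-cycleType v = Vecₚ.lookup∘tabulate _

mult-suc-toℕ : ∀ {n} (a : Vec ℕ n) i → mult a (suc (toℕ i)) ≡ lookup a i
mult-suc-toℕ {n} a i = trans (∑-cong (allFin n) as-𝟙) (AllFin.∑-sift i (lookup a))
  where
  as-𝟙 : ∀ j → (if does (suc (toℕ j) ℕ.≟ suc (toℕ i)) then lookup a j else 0) ≡ 𝟙[ j Finₚ.≟ i ] * lookup a j
  as-𝟙 j with j Finₚ.≟ i
  ... | yes refl = trans (if-does-yes (suc (toℕ j) ℕ.≟ suc (toℕ j)) refl) (sym (ℕₚ.+-identityʳ (lookup a j)))
  ... | no j≢i   = if-does-no (suc (toℕ j) ℕ.≟ suc (toℕ i)) (j≢i ∘ Finₚ.toℕ-injective ∘ ℕₚ.suc-injective)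

∑-symmetric-even : ∀ n (s : Fin n → Fin n → ℕ) → (∀ x y → s x y ≡ s y x) → (∀ x → s x x ≡ 0) →
                   2 ∣ ∑[ x ∈ allFin n ] ∑[ y ∈ allFin n ] s x y
∑-symmetric-even zero    s s-sym s-diag = divides 0 refl
∑-symmetric-even (suc n) s s-sym s-diag = subst (2 ∣_) (sym split) (∣m∣n⇒∣m+n (divides A A+A≡A*2) rest-even)
  where
  open ≡-Reasoning
  A R : ℕ
  A = ∑[ y ∈ allFin n ] s Fin.zero (Fin.suc y)
  R = ∑[ x ∈ allFin n ] ∑[ y ∈ allFin n ] s (Fin.suc x) (Fin.suc y)
  rest-even : 2 ∣ R
  rest-even = ∑-symmetric-even n (λ x y → s (Fin.suc x) (Fin.suc y)) (λ x y → s-sym (Fin.suc x) (Fin.suc y)) (s-diag ∘ Fin.suc)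
  A+A≡A*2 : A + A ≡ A * 2
  A+A≡A*2 = trans (cong (A +_) (sym (ℕₚ.+-identityʳ A))) (ℕₚ.*-comm 2 A)
  split : ∑[ x ∈ allFin (suc n) ] ∑[ y ∈ allFin (suc n) ] s x y ≡ A + A + R
  split = begin
    ∑[ x ∈ allFin (suc n) ] ∑[ y ∈ allFin (suc n) ] s x y
      ≡⟨ ∑-allFin-suc n _ ⟩
    ∑[ y ∈ allFin (suc n) ] s Fin.zero y + ∑[ x ∈ allFin n ] ∑[ y ∈ allFin (suc n) ] s (Fin.suc x) y
      ≡⟨ cong₂ _+_ (∑-allFin-suc n _) (∑-cong (allFin n) (λ x → ∑-allFin-suc n _)) ⟩
    s Fin.zero Fin.zero + A + ∑[ x ∈ allFin n ] (s (Fin.suc x) Fin.zero + ∑[ y ∈ allFin n ] s (Fin.suc x) (Fin.suc y))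
      ≡⟨ cong₂ _+_ (cong (_+ A) (s-diag Fin.zero)) (∑-distrib (allFin n) _ _) ⟩
    A + (∑[ x ∈ allFin n ] s (Fin.suc x) Fin.zero + R)
      ≡⟨ cong (λ B → A + (B + R)) (∑-cong (allFin n) (λ x → s-sym (Fin.suc x) Fin.zero)) ⟩
    A + (A + R)
      ≡⟨ ℕₚ.+-assoc A A R ⟨
    A + A + R ∎

module _ {n : ℕ} (v : Vec (Fin (suc n)) (suc n)) where

  private
    _≟_ : DecidableEquality (Fin (suc n))
    _≟_ = Finₚ._≟_
    all : List (Fin (suc n))
    all = allFin (suc n)
    swapped : ∀ x → Dec (lookup v x ≢ x × lookup v (lookup v x) ≡ x)
    swapped x = ¬? (lookup v x ≟ x) ×-dec (lookup v (lookup v x) ≟ x)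

  fixedPoints≡mult₁ : fixedPoints v ≡ mult (cycleType v) 1
  fixedPoints≡mult₁ = begin
    fixedPoints v                          ≡⟨ ∑-cong all (λ x → sym (𝟙-cycLen≡1 v x)) ⟩
    ∑[ x ∈ all ] 𝟙[ cycLen v x ℕ.≟ 1 ]     ≡⟨ length-filter _ all ⟨
    onCycles v 1                           ≡⟨ n/1≡n (onCycles v 1) ⟨
    onCycles v 1 / 1                       ≡⟨ lookup-cycleType v Fin.zero ⟨
    lookup (cycleType v) Fin.zero          ≡⟨ mult-suc-toℕ (cycleType v) Fin.zero ⟨
    mult (cycleType v) 1                   ∎
    where open ≡-Reasoning

  onCycles₂≡∑swapped : onCycles v 2 ≡ ∑[ x ∈ all ] 𝟙[ swapped x ]
  onCycles₂≡∑swapped = trans (length-filter _ all) (∑-cong all (𝟙-cycLen≡2 v))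

  squareFixedPoints≡ : squareFixedPoints v ≡ fixedPoints v + onCycles v 2
  squareFixedPoints≡ = begin
    squareFixedPoints v                                        ≡⟨ ∑-cong all split ⟩
    ∑[ x ∈ all ] (𝟙[ lookup v x ≟ x ] + 𝟙[ swapped x ])        ≡⟨ ∑-distrib all (λ x → 𝟙[ lookup v x ≟ x ]) (λ x → 𝟙[ swapped x ]) ⟩
    fixedPoints v + ∑[ x ∈ all ] 𝟙[ swapped x ]                ≡⟨ cong (fixedPoints v +_) onCycles₂≡∑swapped ⟨
    fixedPoints v + onCycles v 2                               ∎
    where
    open ≡-Reasoning
    split : ∀ x → 𝟙[ lookup v (lookup v x) ≟ x ] ≡ 𝟙[ lookup v x ≟ x ] + 𝟙[ swapped x ]
    split x with lookup v x ≟ x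
    ... | yes vx≡x = 𝟙-yes (lookup v (lookup v x) ≟ x) (trans (cong (lookup v) vx≡x) vx≡x)
    ... | no _     = refl

  onCycles₂-even : 2 ∣ onCycles v 2
  onCycles₂-even = subst (2 ∣_) (trans (∑-cong all row) (sym onCycles₂≡∑swapped)) (∑-symmetric-even (suc n) s s-sym s-diag)
    where
    open CommutativeSemigroupProperties ℕₚ.*-commutativeSemigroup using (x∙yz≈z∙yx)
    s : Fin (suc n) → Fin (suc n) → ℕ
    s x y = 𝟙[ lookup v x ≟ y ] * (𝟙[ ¬? (y ≟ x) ] * 𝟙[ lookup v y ≟ x ])
    s-sym : ∀ x y → s x y ≡ s y x
    s-sym x y = trans (cong (λ d → 𝟙[ lookup v x ≟ y ] * (d * 𝟙[ lookup v y ≟ x ]))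
                            (𝟙-⇔ (¬? (y ≟ x)) (¬? (x ≟ y)) (λ y≢x → y≢x ∘ sym) (λ x≢y → x≢y ∘ sym)))
                      (x∙yz≈z∙yx 𝟙[ lookup v x ≟ y ] 𝟙[ ¬? (x ≟ y) ] 𝟙[ lookup v y ≟ x ])
    s-diag : ∀ x → s x x ≡ 0
    s-diag x = trans (cong (λ d → 𝟙[ lookup v x ≟ x ] * (d * 𝟙[ lookup v x ≟ x ])) (𝟙-no (¬? (x ≟ x)) (λ x≢x → x≢x refl)))
                     (ℕₚ.*-zeroʳ 𝟙[ lookup v x ≟ x ])
    row : ∀ x → ∑[ y ∈ all ] s x y ≡ 𝟙[ swapped x ]
    row x = trans (AllFin.∑-sift′ (lookup v x) (λ y → 𝟙[ ¬? (y ≟ x) ] * 𝟙[ lookup v y ≟ x ]))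
                  (sym (𝟙-× (¬? (lookup v x ≟ x)) (lookup v (lookup v x) ≟ x)))

onCycles₂≡2*mult₂ : ∀ {n} (v : Vec (Fin (suc n)) (suc n)) → onCycles v 2 ≡ 2 * mult (cycleType v) 2
onCycles₂≡2*mult₂ {zero}  (Fin.zero Vec.∷ Vec.[]) = refl
onCycles₂≡2*mult₂ {suc n} v = begin
  onCycles v 2                          ≡⟨ m*[n/m]≡n (onCycles₂-even v) ⟨
  2 * (onCycles v 2 / 2)                ≡⟨ cong (2 *_) (lookup-cycleType v (Fin.suc Fin.zero)) ⟨
  2 * lookup (cycleType v) (Fin.suc Fin.zero) ≡⟨ cong (2 *_) (mult-suc-toℕ (cycleType v) (Fin.suc Fin.zero)) ⟨
  2 * mult (cycleType v) 2              ∎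
  where open ≡-Reasoning

squareFixedPoints≡mult : ∀ {n} (v : Vec (Fin (suc n)) (suc n)) →
                         squareFixedPoints v ≡ mult (cycleType v) 1 + 2 * mult (cycleType v) 2
squareFixedPoints≡mult v = trans (squareFixedPoints≡ v) (cong₂ _+_ (fixedPoints≡mult₁ v) (onCycles₂≡2*mult₂ v))

fixedPoints-of-type : ∀ {n a} (v : Vec (Fin (suc n)) (suc n)) → cycleType v ≡ a → fixedPoints v ≡ mult a 1
fixedPoints-of-type v refl = fixedPoints≡mult₁ v

squareFixedPoints-of-type : ∀ {n a} (v : Vec (Fin (suc n)) (suc n)) → cycleType v ≡ a →
                            squareFixedPoints v ≡ mult a 1 + 2 * mult a 2
squareFixedPoints-of-type v refl = squareFixedPoints≡mult v

cycleSucc : ℕ → ℕ → ℕ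
cycleSucc ℓ x = if does (suc x ℕ.<? ℓ) then suc x else 0

-- The points 0, 1, …, ∑ L id - 1 are cut into consecutive blocks whose lengths are listed in L,
-- and each block is rotated cyclically.
blockRotation : List ℕ → ℕ → ℕ
blockRotation []      x = x
blockRotation (ℓ ∷ L) x = if does (x ℕ.<? ℓ) then cycleSucc ℓ x else ℓ + blockRotation L (x ∸ ℓ)

blockLength : List ℕ → ℕ → ℕ
blockLength []      x = 0
blockLength (ℓ ∷ L) x = if does (x ℕ.<? ℓ) then ℓ else blockLength L (x ∸ ℓ)

<-or-offset : ∀ ℓ x → x < ℓ ⊎ ∃[ y ] x ≡ ℓ + y
<-or-offset ℓ x with x ℕ.<? ℓ
... | yes x<ℓ = inj₁ x<ℓ
... | no x≮ℓ  = inj₂ (x ∸ ℓ , sym (ℕₚ.m+[n∸m]≡n (ℕₚ.≮⇒≥ x≮ℓ)))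

module _ (ℓ : ℕ) (L : List ℕ) where

  blockRotation-head : ∀ {x} → x < ℓ → blockRotation (ℓ ∷ L) x ≡ cycleSucc ℓ x
  blockRotation-head {x} = if-does-yes (x ℕ.<? ℓ)

  blockRotation-tail : ∀ y → blockRotation (ℓ ∷ L) (ℓ + y) ≡ ℓ + blockRotation L y
  blockRotation-tail y = trans (if-does-no ((ℓ + y) ℕ.<? ℓ) (ℕₚ.m+n≮m ℓ y)) (cong (λ z → ℓ + blockRotation L z) (ℕₚ.m+n∸m≡n ℓ y))

  blockLength-head : ∀ {x} → x < ℓ → blockLength (ℓ ∷ L) x ≡ ℓ
  blockLength-head {x} = if-does-yes (x ℕ.<? ℓ)

  blockLength-tail : ∀ y → blockLength (ℓ ∷ L) (ℓ + y) ≡ blockLength L y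
  blockLength-tail y = trans (if-does-no ((ℓ + y) ℕ.<? ℓ) (ℕₚ.m+n≮m ℓ y)) (cong (blockLength L) (ℕₚ.m+n∸m≡n ℓ y))

module _ (ℓ : ℕ) where

  cycleSucc-yes : ∀ {x} → suc x < ℓ → cycleSucc ℓ x ≡ suc x
  cycleSucc-yes {x} = if-does-yes (suc x ℕ.<? ℓ)

  cycleSucc-no : ∀ {x} → ¬ suc x < ℓ → cycleSucc ℓ x ≡ 0
  cycleSucc-no {x} = if-does-no (suc x ℕ.<? ℓ)

  cycleSucc-< : ∀ {x} → x < ℓ → cycleSucc ℓ x < ℓ
  cycleSucc-< {x} x<ℓ with suc x ℕ.<? ℓ
  ... | yes 1+x<ℓ = subst (_< ℓ) (sym (cycleSucc-yes 1+x<ℓ)) 1+x<ℓ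
  ... | no 1+x≮ℓ  = subst (_< ℓ) (sym (cycleSucc-no 1+x≮ℓ)) (ℕₚ.≤-<-trans z≤n x<ℓ)

  cycleSucc-injective : ∀ {x y} → x < ℓ → y < ℓ → cycleSucc ℓ x ≡ cycleSucc ℓ y → x ≡ y
  cycleSucc-injective {x} {y} x<ℓ y<ℓ eq with suc x ℕ.<? ℓ | suc y ℕ.<? ℓ
  ... | yes 1+x<ℓ | yes 1+y<ℓ = ℕₚ.suc-injective (trans (sym (cycleSucc-yes 1+x<ℓ)) (trans eq (cycleSucc-yes 1+y<ℓ)))
  ... | yes 1+x<ℓ | no 1+y≮ℓ  = ⊥-elim (ℕₚ.1+n≢0 (trans (sym (cycleSucc-yes 1+x<ℓ)) (trans eq (cycleSucc-no 1+y≮ℓ))))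
  ... | no 1+x≮ℓ  | yes 1+y<ℓ = ⊥-elim (ℕₚ.1+n≢0 (trans (sym (cycleSucc-yes 1+y<ℓ)) (trans (sym eq) (cycleSucc-no 1+x≮ℓ))))
  ... | no 1+x≮ℓ  | no 1+y≮ℓ  = ℕₚ.suc-injective (trans (ℕₚ.≤-antisym x<ℓ (ℕₚ.≮⇒≥ 1+x≮ℓ)) (ℕₚ.≤-antisym (ℕₚ.≮⇒≥ 1+y≮ℓ) y<ℓ))

  fold-cycleSucc-< : ∀ {x} k → x < ℓ → fold x (cycleSucc ℓ) k < ℓ
  fold-cycleSucc-< zero    x<ℓ = x<ℓ
  fold-cycleSucc-< (suc k) x<ℓ = cycleSucc-< (fold-cycleSucc-< k x<ℓ)

  fold-cycleSucc-+ : ∀ x j → x + j < ℓ → fold x (cycleSucc ℓ) j ≡ x + j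
  fold-cycleSucc-+ x zero    _       = sym (ℕₚ.+-identityʳ x)
  fold-cycleSucc-+ x (suc j) x+1+j<ℓ = begin
    cycleSucc ℓ (fold x (cycleSucc ℓ) j)  ≡⟨ cong (cycleSucc ℓ) (fold-cycleSucc-+ x j (ℕₚ.<-trans (ℕₚ.+-monoʳ-< x (ℕₚ.n<1+n j)) x+1+j<ℓ)) ⟩
    cycleSucc ℓ (x + j)                   ≡⟨ cycleSucc-yes (subst (_< ℓ) (ℕₚ.+-suc x j) x+1+j<ℓ) ⟩
    suc (x + j)                           ≡⟨ ℕₚ.+-suc x j ⟨
    x + suc j                             ∎
    where open ≡-Reasoning

blockRotation-< : ∀ L {x} → x < ∑ L id → blockRotation L x < ∑ L id
blockRotation-< (ℓ ∷ L) {x} x<∑ with <-or-offset ℓ x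
... | inj₁ x<ℓ = subst (_< ℓ + ∑ L id) (sym (blockRotation-head ℓ L x<ℓ)) (ℕₚ.<-≤-trans (cycleSucc-< ℓ x<ℓ) (ℕₚ.m≤m+n ℓ (∑ L id)))
... | inj₂ (y , refl) = subst (_< ℓ + ∑ L id) (sym (blockRotation-tail ℓ L y))
                              (ℕₚ.+-monoʳ-< ℓ (blockRotation-< L (ℕₚ.+-cancelˡ-< ℓ y (∑ L id) x<∑)))

blockRotation-injective : ∀ L {x y} → x < ∑ L id → y < ∑ L id → blockRotation L x ≡ blockRotation L y → x ≡ y
blockRotation-injective (ℓ ∷ L) {x} {y} x<∑ y<∑ eq with <-or-offset ℓ x | <-or-offset ℓ y
... | inj₁ x<ℓ | inj₁ y<ℓ =
  cycleSucc-injective ℓ x<ℓ y<ℓ (trans (sym (blockRotation-head ℓ L x<ℓ)) (trans eq (blockRotation-head ℓ L y<ℓ)))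
... | inj₁ x<ℓ | inj₂ (y′ , refl) = ⊥-elim (ℕₚ.m+n≮m ℓ (blockRotation L y′)
  (subst (_< ℓ) (trans (sym (blockRotation-head ℓ L x<ℓ)) (trans eq (blockRotation-tail ℓ L y′))) (cycleSucc-< ℓ x<ℓ)))
... | inj₂ (x′ , refl) | inj₁ y<ℓ = ⊥-elim (ℕₚ.m+n≮m ℓ (blockRotation L x′)
  (subst (_< ℓ) (trans (sym (blockRotation-head ℓ L y<ℓ)) (trans (sym eq) (blockRotation-tail ℓ L x′))) (cycleSucc-< ℓ y<ℓ)))
... | inj₂ (x′ , refl) | inj₂ (y′ , refl) = cong (ℓ +_) (blockRotation-injective L
  (ℕₚ.+-cancelˡ-< ℓ x′ (∑ L id) x<∑) (ℕₚ.+-cancelˡ-< ℓ y′ (∑ L id) y<∑)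
  (ℕₚ.+-cancelˡ-≡ ℓ _ _ (trans (sym (blockRotation-tail ℓ L x′)) (trans eq (blockRotation-tail ℓ L y′)))))

module _ (ℓ : ℕ) (L : List ℕ) where

  fold-blockRotation-head : ∀ {x} k → x < ℓ → fold x (blockRotation (ℓ ∷ L)) k ≡ fold x (cycleSucc ℓ) k
  fold-blockRotation-head zero    x<ℓ = refl
  fold-blockRotation-head (suc k) x<ℓ = trans (cong (blockRotation (ℓ ∷ L)) (fold-blockRotation-head k x<ℓ))
                                              (blockRotation-head ℓ L (fold-cycleSucc-< ℓ k x<ℓ))

  fold-blockRotation-tail : ∀ y k → fold (ℓ + y) (blockRotation (ℓ ∷ L)) k ≡ ℓ + fold y (blockRotation L) k
  fold-blockRotation-tail y zero    = refl
  fold-blockRotation-tail y (suc k) = trans (cong (blockRotation (ℓ ∷ L)) (fold-blockRotation-tail y k))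
                                            (blockRotation-tail ℓ L _)

module CycleSucc (x d : ℕ) where

  private
    ℓ : ℕ
    ℓ = suc (x + d)

  wraps : fold x (cycleSucc ℓ) (suc d) ≡ 0
  wraps = trans (cong (cycleSucc ℓ) (fold-cycleSucc-+ ℓ x d (ℕₚ.n<1+n (x + d)))) (cycleSucc-no ℓ (ℕₚ.<-irrefl refl))

  period : fold x (cycleSucc ℓ) ℓ ≡ x
  period = begin
    fold x (cycleSucc ℓ) (suc (x + d))           ≡⟨ cong (fold x (cycleSucc ℓ)) (ℕₚ.+-suc x d) ⟨
    fold x (cycleSucc ℓ) (x + suc d)             ≡⟨ fold-+ x (cycleSucc ℓ) x ⟩
    fold (fold x (cycleSucc ℓ) (suc d)) (cycleSucc ℓ) x ≡⟨ cong (λ z → fold z (cycleSucc ℓ) x) wraps ⟩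
    fold 0 (cycleSucc ℓ) x                       ≡⟨ fold-cycleSucc-+ ℓ 0 x (s≤s (ℕₚ.m≤m+n x d)) ⟩
    x                                            ∎
    where open ≡-Reasoning

  minimal : ∀ k → 1 ≤ k → k < ℓ → fold x (cycleSucc ℓ) k ≢ x
  minimal k 1≤k k<ℓ returns with k ℕ.≤? d
  ... | yes k≤d = ℕₚ.1+n≰n (subst (1 ≤_) k≡0 1≤k)
    where
    k≡0 : k ≡ 0
    k≡0 = ℕₚ.+-cancelˡ-≡ x k 0 (trans (sym (fold-cycleSucc-+ ℓ x k (s≤s (ℕₚ.+-monoʳ-≤ x k≤d))))
                                      (trans returns (sym (ℕₚ.+-identityʳ x))))
  ... | no k≰d = ℕₚ.<-irrefl j≡x j<x
    where
    j : ℕ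
    j = k ∸ suc d
    1+d+j≡k : suc d + j ≡ k
    1+d+j≡k = ℕₚ.m+[n∸m]≡n (ℕₚ.≰⇒> k≰d)
    j<x : j < x
    j<x = ℕₚ.+-cancelˡ-< (suc d) j x (subst (_< suc d + x) (sym 1+d+j≡k) (subst (k <_) (cong suc (ℕₚ.+-comm x d)) k<ℓ))
    j≡x : j ≡ x
    j≡x = begin
      j                                             ≡⟨ fold-cycleSucc-+ ℓ 0 j (ℕₚ.<-trans j<x (s≤s (ℕₚ.m≤m+n x d))) ⟨
      fold 0 (cycleSucc ℓ) j                        ≡⟨ cong (λ z → fold z (cycleSucc ℓ) j) wraps ⟨
      fold (fold x (cycleSucc ℓ) (suc d)) (cycleSucc ℓ) j ≡⟨ fold-+ x (cycleSucc ℓ) j ⟨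
      fold x (cycleSucc ℓ) (j + suc d)              ≡⟨ cong (fold x (cycleSucc ℓ)) (trans (ℕₚ.+-comm j (suc d)) 1+d+j≡k) ⟩
      fold x (cycleSucc ℓ) k                        ≡⟨ returns ⟩
      x                                             ∎
      where open ≡-Reasoning

<-as-suc+ : ∀ {x ℓ} → x < ℓ → ∃[ d ] suc (x + d) ≡ ℓ
<-as-suc+ {x} {ℓ} x<ℓ = ℓ ∸ suc x , ℕₚ.m+[n∸m]≡n x<ℓ

blockLength-period : ∀ L {x} → x < ∑ L id → fold x (blockRotation L) (blockLength L x) ≡ x
blockLength-period (ℓ ∷ L) {x} x<∑ with <-or-offset ℓ x
... | inj₁ x<ℓ with <-as-suc+ x<ℓ
...   | d , refl = trans (cong (fold x (blockRotation (ℓ ∷ L))) (blockLength-head ℓ L x<ℓ))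
                         (trans (fold-blockRotation-head ℓ L ℓ x<ℓ) (CycleSucc.period x d))
blockLength-period (ℓ ∷ L) x<∑ | inj₂ (y , refl) =
  trans (cong (fold (ℓ + y) (blockRotation (ℓ ∷ L))) (blockLength-tail ℓ L y))
        (trans (fold-blockRotation-tail ℓ L y (blockLength L y)) (cong (ℓ +_) (blockLength-period L (ℕₚ.+-cancelˡ-< ℓ y (∑ L id) x<∑))))

blockLength-minimal : ∀ L {x} → x < ∑ L id → ∀ k → 1 ≤ k → k < blockLength L x → fold x (blockRotation L) k ≢ x
blockLength-minimal (ℓ ∷ L) {x} x<∑ k 1≤k k<len with <-or-offset ℓ x
... | inj₁ x<ℓ with <-as-suc+ x<ℓ
...   | d , refl = λ returns → CycleSucc.minimal x d k 1≤k (subst (k <_) (blockLength-head ℓ L x<ℓ) k<len)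
                                                   (trans (sym (fold-blockRotation-head ℓ L k x<ℓ)) returns)
blockLength-minimal (ℓ ∷ L) x<∑ k 1≤k k<len | inj₂ (y , refl) = λ returns →
  blockLength-minimal L (ℕₚ.+-cancelˡ-< ℓ y (∑ L id) x<∑) k 1≤k (subst (k <_) (blockLength-tail ℓ L y) k<len)
    (ℕₚ.+-cancelˡ-≡ ℓ _ _ (trans (sym (fold-blockRotation-tail ℓ L y k)) returns))

blockLength-pos : ∀ L {x} → x < ∑ L id → 1 ≤ blockLength L x
blockLength-pos (ℓ ∷ L) {x} x<∑ with <-or-offset ℓ x
... | inj₁ x<ℓ = subst (1 ≤_) (sym (blockLength-head ℓ L x<ℓ)) (ℕₚ.≤-<-trans z≤n x<ℓ)
... | inj₂ (y , refl) = subst (1 ≤_) (sym (blockLength-tail ℓ L y)) (blockLength-pos L (ℕₚ.+-cancelˡ-< ℓ y (∑ L id) x<∑))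

blockLength-≤ : ∀ L {x} → x < ∑ L id → blockLength L x ≤ ∑ L id
blockLength-≤ (ℓ ∷ L) {x} x<∑ with <-or-offset ℓ x
... | inj₁ x<ℓ = subst (_≤ ℓ + ∑ L id) (sym (blockLength-head ℓ L x<ℓ)) (ℕₚ.m≤m+n ℓ (∑ L id))
... | inj₂ (y , refl) = subst (_≤ ℓ + ∑ L id) (sym (blockLength-tail ℓ L y))
                              (ℕₚ.≤-trans (blockLength-≤ L (ℕₚ.+-cancelˡ-< ℓ y (∑ L id) x<∑)) (ℕₚ.m≤n+m (∑ L id) ℓ))

∑< : ℕ → (ℕ → ℕ) → ℕ
∑< zero    g = 0
∑< (suc m) g = g 0 + ∑< m (g ∘ suc)

∑<-+ : ∀ a b g → ∑< (a + b) g ≡ ∑< a g + ∑< b (λ y → g (a + y))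
∑<-+ zero    b g = refl
∑<-+ (suc a) b g = trans (cong (g 0 +_) (∑<-+ a b (g ∘ suc))) (sym (ℕₚ.+-assoc (g 0) _ _))

∑<-cong : ∀ m {g h : ℕ → ℕ} → (∀ x → x < m → g x ≡ h x) → ∑< m g ≡ ∑< m h
∑<-cong zero    g≡h = refl
∑<-cong (suc m) g≡h = cong₂ _+_ (g≡h 0 (s≤s z≤n)) (∑<-cong m (λ x x<m → g≡h (suc x) (s≤s x<m)))

∑<-const : ∀ m {g : ℕ → ℕ} {c} → (∀ x → x < m → g x ≡ c) → ∑< m g ≡ m * c
∑<-const zero    g≡c = refl
∑<-const (suc m) g≡c = cong₂ _+_ (g≡c 0 (s≤s z≤n)) (∑<-const m (λ x x<m → g≡c (suc x) (s≤s x<m)))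

∑-allFin-toℕ : ∀ n (g : ℕ → ℕ) → ∑ (allFin n) (g ∘ toℕ) ≡ ∑< n g
∑-allFin-toℕ zero    g = refl
∑-allFin-toℕ (suc n) g = trans (∑-allFin-suc n (g ∘ toℕ)) (cong (g 0 +_) (∑-allFin-toℕ n (g ∘ suc)))

occurrences : ℕ → List ℕ → ℕ
occurrences c L = ∑[ ℓ ∈ L ] 𝟙[ ℓ ℕ.≟ c ]

#blockLength : ∀ L c → ∑< (∑ L id) (λ x → 𝟙[ blockLength L x ℕ.≟ c ]) ≡ c * occurrences c L
#blockLength []      c = sym (ℕₚ.*-zeroʳ c)
#blockLength (ℓ ∷ L) c = begin
  ∑< (ℓ + ∑ L id) (λ x → 𝟙[ blockLength (ℓ ∷ L) x ℕ.≟ c ])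
    ≡⟨ ∑<-+ ℓ (∑ L id) _ ⟩
  ∑< ℓ (λ x → 𝟙[ blockLength (ℓ ∷ L) x ℕ.≟ c ]) + ∑< (∑ L id) (λ y → 𝟙[ blockLength (ℓ ∷ L) (ℓ + y) ℕ.≟ c ])
    ≡⟨ cong₂ _+_ (∑<-const ℓ (λ x x<ℓ → cong (λ z → 𝟙[ z ℕ.≟ c ]) (blockLength-head ℓ L x<ℓ)))
                 (∑<-cong (∑ L id) (λ y _ → cong (λ z → 𝟙[ z ℕ.≟ c ]) (blockLength-tail ℓ L y))) ⟩
  ℓ * 𝟙[ ℓ ℕ.≟ c ] + ∑< (∑ L id) (λ y → 𝟙[ blockLength L y ℕ.≟ c ])
    ≡⟨ cong₂ _+_ (ℓ𝟙≡c𝟙 ℓ) (#blockLength L c) ⟩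
  c * 𝟙[ ℓ ℕ.≟ c ] + c * occurrences c L
    ≡⟨ ℕₚ.*-distribˡ-+ c _ _ ⟨
  c * occurrences c (ℓ ∷ L) ∎
  where
  open ≡-Reasoning
  ℓ𝟙≡c𝟙 : ∀ ℓ → ℓ * 𝟙[ ℓ ℕ.≟ c ] ≡ c * 𝟙[ ℓ ℕ.≟ c ]
  ℓ𝟙≡c𝟙 ℓ = trans (ℕₚ.*-comm ℓ 𝟙[ ℓ ℕ.≟ c ]) (trans (𝟙-guard (ℓ ℕ.≟ c) id) (ℕₚ.*-comm 𝟙[ ℓ ℕ.≟ c ] c))

firstReturn-≡ : ∀ {n} (v : Vec (Fin n) n) x fuel k p → k ≤ p → p < k + fuel →
                (∀ j → k ≤ j → j < p → iter v j x ≢ x) → iter v p x ≡ x → firstReturn v x fuel k ≡ p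
firstReturn-≡ v x zero k p k≤p p<k+0 _ _ = ⊥-elim (ℕₚ.<⇒≱ (subst (p <_) (ℕₚ.+-identityʳ k) p<k+0) k≤p)
firstReturn-≡ v x (suc fuel) k p k≤p p<k+fuel earlier returns with iter v k x Finₚ.≟ x
... | yes returns-at-k with ℕₚ.m≤n⇒m<n∨m≡n k≤p
...   | inj₁ k<p = ⊥-elim (earlier k ℕₚ.≤-refl k<p returns-at-k)
...   | inj₂ k≡p = k≡p
firstReturn-≡ v x (suc fuel) k p k≤p p<k+fuel earlier returns | no ¬returns-at-k =
  firstReturn-≡ v x fuel (suc k) p k<p (subst (p <_) (ℕₚ.+-suc k fuel) p<k+fuel) (λ j k<j j<p → earlier j (ℕₚ.<⇒≤ k<j) j<p) returns
  where
  k<p : k < p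
  k<p = ℕₚ.≤∧≢⇒< k≤p (λ k≡p → ¬returns-at-k (subst (λ z → iter v z x ≡ x) (sym k≡p) returns))

module BlockPermutation (n : ℕ) (L : List ℕ) (∑L≡n : ∑ L id ≡ n) where

  private
    toℕ<∑L : (x : Fin n) → toℕ x < ∑ L id
    toℕ<∑L x = subst (toℕ x <_) (sym ∑L≡n) (Finₚ.toℕ<n x)

    rotation-< : (x : Fin n) → blockRotation L (toℕ x) < n
    rotation-< x = subst (blockRotation L (toℕ x) <_) ∑L≡n (blockRotation-< L (toℕ<∑L x))

  perm : Vec (Fin n) n
  perm = Vec.tabulate (λ x → Fin.fromℕ< (rotation-< x))

  toℕ-lookup : ∀ x → toℕ (lookup perm x) ≡ blockRotation L (toℕ x)
  toℕ-lookup x = trans (cong toℕ (Vecₚ.lookup∘tabulate _ x)) (Finₚ.toℕ-fromℕ< (rotation-< x))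

  perm-isPerm : IsPerm perm
  perm-isPerm i j eq = Finₚ.toℕ-injective (blockRotation-injective L (toℕ<∑L i) (toℕ<∑L j)
    (trans (sym (toℕ-lookup i)) (trans (cong toℕ eq) (toℕ-lookup j))))

  toℕ-iter : ∀ k x → toℕ (iter perm k x) ≡ fold (toℕ x) (blockRotation L) k
  toℕ-iter zero    x = refl
  toℕ-iter (suc k) x = trans (toℕ-lookup (iter perm k x)) (cong (blockRotation L) (toℕ-iter k x))

  cycLen≡blockLength : ∀ x → cycLen perm x ≡ blockLength L (toℕ x)
  cycLen≡blockLength x = firstReturn-≡ perm x n 1 (blockLength L (toℕ x))
    (blockLength-pos L (toℕ<∑L x))
    (s≤s (subst (blockLength L (toℕ x) ≤_) ∑L≡n (blockLength-≤ L (toℕ<∑L x))))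
    (λ j 1≤j j<len returns → blockLength-minimal L (toℕ<∑L x) j 1≤j j<len (trans (sym (toℕ-iter j x)) (cong toℕ returns)))
    (Finₚ.toℕ-injective (trans (toℕ-iter (blockLength L (toℕ x)) x) (blockLength-period L (toℕ<∑L x))))

  onCycles-perm : ∀ c → onCycles perm c ≡ c * occurrences c L
  onCycles-perm c = begin
    onCycles perm c                                      ≡⟨ length-filter _ (allFin n) ⟩
    ∑[ x ∈ allFin n ] 𝟙[ cycLen perm x ℕ.≟ c ]           ≡⟨ ∑-cong (allFin n) (λ x → cong (λ z → 𝟙[ z ℕ.≟ c ]) (cycLen≡blockLength x)) ⟩
    ∑[ x ∈ allFin n ] 𝟙[ blockLength L (toℕ x) ℕ.≟ c ]   ≡⟨ ∑-allFin-toℕ n (λ y → 𝟙[ blockLength L y ℕ.≟ c ]) ⟩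
    ∑< n (λ y → 𝟙[ blockLength L y ℕ.≟ c ])              ≡⟨ cong (λ m → ∑< m (λ y → 𝟙[ blockLength L y ℕ.≟ c ])) ∑L≡n ⟨
    ∑< (∑ L id) (λ y → 𝟙[ blockLength L y ℕ.≟ c ])       ≡⟨ #blockLength L c ⟩
    c * occurrences c L                                  ∎
    where open ≡-Reasoning

∑-replicate : ∀ m c (f : ℕ → ℕ) → ∑ (replicate m c) f ≡ m * f c
∑-replicate zero    c f = refl
∑-replicate (suc m) c f = cong (f c +_) (∑-replicate m c f)

cycleLengths : ∀ {n} → Vec ℕ n → List ℕ
cycleLengths {n} a = concatMap (λ i → replicate (lookup a i) (suc (toℕ i))) (allFin n)

∑-cycleLengths : ∀ {n} (a : Vec ℕ n) → IsPartition n a → ∑ (cycleLengths a) id ≡ n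
∑-cycleLengths {n} a a⊢n = trans (∑-concatMap (λ i → replicate (lookup a i) (suc (toℕ i))) (allFin n) id)
  (trans (∑-cong (allFin n) (λ i → trans (∑-replicate (lookup a i) (suc (toℕ i)) id) (ℕₚ.*-comm (lookup a i) (suc (toℕ i))))) a⊢n)

occurrences-cycleLengths : ∀ {n} (a : Vec ℕ n) j → occurrences (suc (toℕ j)) (cycleLengths a) ≡ lookup a j
occurrences-cycleLengths {n} a j = begin
  occurrences (suc (toℕ j)) (cycleLengths a)
    ≡⟨ ∑-concatMap (λ i → replicate (lookup a i) (suc (toℕ i))) (allFin n) _ ⟩
  ∑[ i ∈ allFin n ] ∑[ ℓ ∈ replicate (lookup a i) (suc (toℕ i)) ] 𝟙[ ℓ ℕ.≟ suc (toℕ j) ]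
    ≡⟨ ∑-cong (allFin n) (λ i → ∑-replicate (lookup a i) (suc (toℕ i)) _) ⟩
  ∑[ i ∈ allFin n ] (lookup a i * 𝟙[ suc (toℕ i) ℕ.≟ suc (toℕ j) ])
    ≡⟨ ∑-cong (allFin n) (λ i → trans (ℕₚ.*-comm (lookup a i) _) (cong (_* lookup a i)
         (𝟙-⇔ (suc (toℕ i) ℕ.≟ suc (toℕ j)) (i Finₚ.≟ j) (Finₚ.toℕ-injective ∘ ℕₚ.suc-injective) (cong (suc ∘ toℕ))))) ⟩
  ∑[ i ∈ allFin n ] (𝟙[ i Finₚ.≟ j ] * lookup a i)
    ≡⟨ AllFin.∑-sift j (lookup a) ⟩
  lookup a j ∎
  where open ≡-Reasoning

withCycleType : ∀ n (a : Vec ℕ n) → IsPartition n a → ∃[ v ] IsPerm v × cycleType v ≡ a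
withCycleType n a a⊢n = perm , perm-isPerm , trans (Vecₚ.tabulate-cong cycleType-entry) (Vecₚ.tabulate∘lookup a)
  where
  open BlockPermutation n (cycleLengths a) (∑-cycleLengths a a⊢n)
  cycleType-entry : ∀ i → onCycles perm (suc (toℕ i)) / suc (toℕ i) ≡ lookup a i
  cycleType-entry i = trans (cong (_/ suc (toℕ i)) (trans (onCycles-perm (suc (toℕ i)))
                                  (trans (ℕₚ.*-comm (suc (toℕ i)) _) (cong (_* suc (toℕ i)) (occurrences-cycleLengths a i)))))
                            (m*n/n≡m (lookup a i) (suc (toℕ i)))

-- x ∼ y states x / p = y / q without dividing.
module Proportion (p q : ℕ) where

  infix 4 _∼_
  record _∼_ (x y : ℕ) : Set where
    constructor cross
    field cross-≡ : x * q ≡ y * p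
  open _∼_ public

  ∼-subst : ∀ {x y x′ y′} → x ≡ x′ → y ≡ y′ → x ∼ y → x′ ∼ y′
  ∼-subst refl refl x∼y = x∼y

  ∼-size : p ∼ q
  ∼-size = cross (ℕₚ.*-comm p q)

  ∼-unit : ∀ c → c * p ∼ c * q
  ∼-unit c = cross (trans (ℕₚ.*-assoc c p q) (trans (cong (c *_) (ℕₚ.*-comm p q)) (sym (ℕₚ.*-assoc c q p))))

  ∼-+ : ∀ {x y x′ y′} → x ∼ y → x′ ∼ y′ → x + x′ ∼ y + y′
  ∼-+ {x} {y} {x′} {y′} (cross xq≡yp) (cross x′q≡y′p) = cross (begin
    (x + x′) * q    ≡⟨ ℕₚ.*-distribʳ-+ q x x′ ⟩
    x * q + x′ * q  ≡⟨ cong₂ _+_ xq≡yp x′q≡y′p ⟩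
    y * p + y′ * p  ≡⟨ ℕₚ.*-distribʳ-+ p y y′ ⟨
    (y + y′) * p    ∎)
    where open ≡-Reasoning

  ∼-*ˡ : ∀ c {x y} → x ∼ y → c * x ∼ c * y
  ∼-*ˡ c {x} {y} (cross xq≡yp) =
    cross (trans (ℕₚ.*-assoc c x q) (trans (cong (c *_) xq≡yp) (sym (ℕₚ.*-assoc c y p))))

  ∼-∑-All : ∀ {a} {A : Set a} {zs : List A} {f g : A → ℕ} → All (λ z → f z ∼ g z) zs → ∑ zs f ∼ ∑ zs g
  ∼-∑-All []             = cross refl
  ∼-∑-All (fz∼gz ∷ rest) = ∼-+ fz∼gz (∼-∑-All rest)

  ∼-∑ : ∀ {a} {A : Set a} (zs : List A) {f g : A → ℕ} → (∀ z → f z ∼ g z) → ∑ zs f ∼ ∑ zs g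
  ∼-∑ []       f∼g = cross refl
  ∼-∑ (z ∷ zs) f∼g = ∼-+ (f∼g z) (∼-∑ zs f∼g)

  ∼-cancel : ∀ {x y x′ y′} c → 1 ≤ c → x + c * x′ ∼ y + c * y′ → x ∼ y → x′ ∼ y′
  ∼-cancel {x} {y} {x′} {y′} c c≥1 (cross sum-≡) (cross xq≡yp) =
    cross (ℕₚ.*-cancelˡ-≡ (x′ * q) (y′ * p) c ⦃ ℕ.>-nonZero c≥1 ⦄ (ℕₚ.+-cancelˡ-≡ (x * q) _ _ (begin
      x * q + c * (x′ * q)    ≡⟨ cong (x * q +_) (ℕₚ.*-assoc c x′ q) ⟨
      x * q + c * x′ * q      ≡⟨ ℕₚ.*-distribʳ-+ q x (c * x′) ⟨
      (x + c * x′) * q        ≡⟨ sum-≡ ⟩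
      (y + c * y′) * p        ≡⟨ ℕₚ.*-distribʳ-+ p y (c * y′) ⟩
      y * p + c * y′ * p      ≡⟨ cong₂ _+_ (sym xq≡yp) (ℕₚ.*-assoc c y′ p) ⟩
      x * q + c * (y′ * p)    ∎)))
    where open ≡-Reasoning

  -- One elimination step: if h is constant off zs, then ∑ h = ∑ zs h + #outside zs * h l determines h l.
  ∼-by-split : ∀ {n} {zs : List (Fin n)} {l} {hᴬ hᴮ : Fin n → ℕ} {Sᴬ Sᴮ} → Unique zs → l ∉ zs →
               (∀ y → y ∉ zs → hᴬ y ≡ hᴬ l) → (∀ y → y ∉ zs → hᴮ y ≡ hᴮ l) →
               ∑ (allFin n) hᴬ ≡ Sᴬ → ∑ (allFin n) hᴮ ≡ Sᴮ → Sᴬ ∼ Sᴮ →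
               All (λ z → hᴬ z ∼ hᴮ z) zs → hᴬ l ∼ hᴮ l
  ∼-by-split {zs = zs} zs-unique l∉zs hᴬ-const hᴮ-const ∑hᴬ ∑hᴮ Sᴬ∼Sᴮ known =
    ∼-cancel (#outside zs) (#outside-pos l∉zs)
      (∼-subst (trans (sym ∑hᴬ) (∑-split-const zs-unique hᴬ-const))
               (trans (sym ∑hᴮ) (∑-split-const zs-unique hᴮ-const)) Sᴬ∼Sᴮ)
      (∼-∑-All known)

module ℚSum = SemiringSum (CommutativeRing.commutativeSemiring ℚₚ.+-*-commutativeRing)
open SemiringMultiplication (CommutativeRing.semiring ℚₚ.+-*-commutativeRing) using () renaming (_×_ to _·_)
open Scaling (CommutativeRing.commutativeSemiring ℚₚ.+-*-commutativeRing) using (×-ratio)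

average-map : ∀ {a} {A : Set a} (f : A → ℚ) xs .{{_ : ℕ.NonZero (length xs)}} →
              average (map f xs) ≡ ℚSum.∑ xs f ℚ.* ((ℤ.+ 1) ℚ./ length xs)
average-map f (x ∷ xs) = cong (λ k → ℚSum.∑ (x ∷ xs) f ℚ.* ((ℤ.+ 1) ℚ./ suc k)) (Listₚ.length-map f xs)

·1ℚ-*-inverse : ∀ c .{{_ : ℕ.NonZero c}} → (c · 1ℚ) ℚ.* ((ℤ.+ 1) ℚ./ c) ≡ 1ℚ
·1ℚ-*-inverse (suc m) = ℚₚ.toℚᵘ-injective (begin-equality
  ℚ.toℚᵘ ((suc m · 1ℚ) ℚ.* ((ℤ.+ 1) ℚ./ suc m))
    ≃⟨ ℚₚ.toℚᵘ-homo-* (suc m · 1ℚ) ((ℤ.+ 1) ℚ./ suc m) ⟩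
  ℚ.toℚᵘ (suc m · 1ℚ) ℚᵘ.* ℚ.toℚᵘ ((ℤ.+ 1) ℚ./ suc m)
    ≃⟨ ℚᵘₚ.*-cong (toℚᵘ-·1ℚ (suc m)) (ℚₚ.toℚᵘ-fromℚᵘ (ℚᵘ.mkℚᵘ (ℤ.+ 1) m)) ⟩
  ℚᵘ.mkℚᵘ (ℤ.+ suc m) 0 ℚᵘ.* ℚᵘ.mkℚᵘ (ℤ.+ 1) m
    ≃⟨ ℚᵘ.*≡* (trans (ℤₚ.*-identityʳ _) (trans (ℤₚ.*-identityʳ (ℤ.+ suc m))
                (sym (trans (ℤₚ.*-identityˡ _) (cong ℤ.+_ (ℕₚ.*-identityˡ (suc m))))))) ⟩
  ℚᵘ.mkℚᵘ (ℤ.+ 1) 0 ∎)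
  where
  open ℚᵘₚ.≤-Reasoning
  toℚᵘ-·1ℚ : ∀ k → ℚ.toℚᵘ (k · 1ℚ) ℚᵘ.≃ ℚᵘ.mkℚᵘ (ℤ.+ k) 0
  toℚᵘ-·1ℚ zero    = ℚᵘ.*≡* refl
  toℚᵘ-·1ℚ (suc k) = ℚᵘₚ.≃-trans (ℚₚ.toℚᵘ-homo-+ 1ℚ (k · 1ℚ))
    (ℚᵘₚ.≃-trans (ℚᵘₚ.+-congʳ (ℚ.toℚᵘ 1ℚ) (toℚᵘ-·1ℚ k))
      (ℚᵘ.*≡* (trans (ℤₚ.*-identityʳ _)
        (trans (cong (ℤ._+_ (ℤ.+ 1)) (ℤₚ.*-identityʳ (ℤ.+ k))) (sym (ℤₚ.*-identityʳ (ℤ.+ suc k)))))))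

module ConjugacyClass (n : ℕ) (a : Vec ℕ n) where

  hasType? : (v : Vec (Fin n) n) → Dec (cycleType v ≡ a)
  hasType? v = Vecₚ.≡-dec ℕ._≟_ (cycleType v) a

  inClass? : (v : Vec (Fin n) n) → Dec (IsPerm v × cycleType v ≡ a)
  inClass? v = isPerm? v ×-dec hasType? v

  ∑-Class : ∀ g → ∑ (Class n a) g ≡ ∑[ v ∈ allVecs n n ] (𝟙[ inClass? v ] * g v)
  ∑-Class g = begin
    ∑ (Class n a) g
      ≡⟨ ∑-filter hasType? (Sym n) g ⟩
    ∑[ v ∈ Sym n ] (𝟙[ hasType? v ] * g v)
      ≡⟨ ∑-filter isPerm? (allVecs n n) (λ v → 𝟙[ hasType? v ] * g v) ⟩
    ∑[ v ∈ allVecs n n ] (𝟙[ isPerm? v ] * (𝟙[ hasType? v ] * g v))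
      ≡⟨ ∑-cong (allVecs n n) (λ v → trans (sym (ℕₚ.*-assoc 𝟙[ isPerm? v ] 𝟙[ hasType? v ] (g v)))
                                            (cong (_* g v) (sym (𝟙-× (isPerm? v) (hasType? v))))) ⟩
    ∑[ v ∈ allVecs n n ] (𝟙[ inClass? v ] * g v) ∎
    where open ≡-Reasoning

  ∈-Class⁻ : ∀ {v} → v ∈ Class n a → IsPerm v × cycleType v ≡ a
  ∈-Class⁻ v∈C with ∈-filter⁻ hasType? {xs = Sym n} v∈C
  ... | v∈Sym , v-type = proj₂ (∈-filter⁻ isPerm? {xs = allVecs n n} v∈Sym) , v-type

  ∑-Class-cong : ∀ {f g} → (∀ v → IsPerm v → cycleType v ≡ a → f v ≡ g v) → ∑ (Class n a) f ≡ ∑ (Class n a) g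
  ∑-Class-cong f≡g = ∑-cong-∈ (Class n a) (λ v∈C → let (v-perm , v-type) = ∈-Class⁻ v∈C in f≡g _ v-perm v-type)

  ∣C∣ : ℕ
  ∣C∣ = length (Class n a)

  ∑-Class-const : ∀ {g c} → (∀ v → IsPerm v → cycleType v ≡ a → g v ≡ c) → ∑ (Class n a) g ≡ c * ∣C∣
  ∑-Class-const {g} {c} g≡c = begin
    ∑ (Class n a) g             ≡⟨ ∑-Class-cong (λ v v-perm v-type → trans (g≡c v v-perm v-type) (sym (ℕₚ.*-identityʳ c))) ⟩
    ∑[ v ∈ Class n a ] (c * 1)  ≡⟨ ∑-*ˡ (Class n a) c (λ _ → 1) ⟩
    c * ∑[ v ∈ Class n a ] 1    ≡⟨ cong (c *_) (length≡∑1 (Class n a)) ⟨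
    c * ∣C∣                     ∎
    where open ≡-Reasoning

  ∑-Class-conj : ∀ t → (∀ x → t (t x) ≡ x) → ∀ g → ∑ (Class n a) (g ∘ conj t) ≡ ∑ (Class n a) g
  ∑-Class-conj t t-involutive g = begin
    ∑ (Class n a) (g ∘ conj t)
      ≡⟨ ∑-Class (g ∘ conj t) ⟩
    ∑[ v ∈ allVecs n n ] (𝟙[ inClass? v ] * g (conj t v))
      ≡⟨ ∑-cong (allVecs n n) (λ v → cong (_* g (conj t v)) (inClass-conj v)) ⟩
    ∑[ v ∈ allVecs n n ] (𝟙[ inClass? (conj t v) ] * g (conj t v))
      ≡⟨ AllVecs.∑-reindex (conj t) conj-involutive (λ v → 𝟙[ inClass? v ] * g v) ⟩
    ∑[ v ∈ allVecs n n ] (𝟙[ inClass? v ] * g v)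
      ≡⟨ ∑-Class g ⟨
    ∑ (Class n a) g ∎
    where
    open ≡-Reasoning
    open Conjugation t t-involutive
    inClass-conj : ∀ v → 𝟙[ inClass? v ] ≡ 𝟙[ inClass? (conj t v) ]
    inClass-conj v = 𝟙-⇔ (inClass? v) (inClass? (conj t v))
      (λ (v-perm , v-type) → conj-isPerm v v-perm , trans (cycleType-conj v) v-type)
      (λ (tv-perm , tv-type) → subst IsPerm (conj-involutive v) (conj-isPerm (conj t v) tv-perm)
                             , trans (sym (cycleType-conj v)) tv-type)

  1≤∣C∣ : IsPartition n a → 1 ≤ ∣C∣
  1≤∣C∣ a⊢n with withCycleType n a a⊢n
  ... | v , v-perm , v-type = subst₂ _≤_
    (cong (_* 1) (𝟙-yes (inClass? v) (v-perm , v-type)))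
    (sym (trans (length≡∑1 (Class n a)) (∑-Class (λ _ → 1))))
    (AllVecs.∑-term-≤ v (λ w → 𝟙[ inClass? w ] * 1))

  #[_↦_] : Fin n → Fin n → ℕ
  #[ i ↦ k ] = ∑[ v ∈ Class n a ] 𝟙[ lookup v i Finₚ.≟ k ]

  #[_↦_,_↦_] : Fin n → Fin n → Fin n → Fin n → ℕ
  #[ i ↦ k , j ↦ l ] = ∑[ v ∈ Class n a ] (𝟙[ lookup v i Finₚ.≟ k ] * 𝟙[ lookup v j Finₚ.≟ l ])

  #[_↦²_] : Fin n → Fin n → ℕ
  #[ i ↦² k ] = ∑[ v ∈ Class n a ] 𝟙[ lookup v (lookup v i) Finₚ.≟ k ]

  module Invariance (t : Fin n → Fin n) (t-involutive : ∀ x → t (t x) ≡ x) where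

    open Conjugation t t-involutive

    private
      𝟙-conj : ∀ v i k → 𝟙[ lookup (conj t v) (t i) Finₚ.≟ t k ] ≡ 𝟙[ lookup v i Finₚ.≟ k ]
      𝟙-conj v i k = trans (cong (λ x → 𝟙[ x Finₚ.≟ t k ]) (lookup-conj v i))
                           (𝟙-⇔ (t (lookup v i) Finₚ.≟ t k) (lookup v i Finₚ.≟ k) t-injective (cong t))

    #₁-invariant : ∀ {i k i′ k′} → t i ≡ i′ → t k ≡ k′ → #[ i ↦ k ] ≡ #[ i′ ↦ k′ ]
    #₁-invariant {i} {k} refl refl = sym (trans
      (sym (∑-Class-conj t t-involutive (λ v → 𝟙[ lookup v (t i) Finₚ.≟ t k ])))
      (∑-cong (Class n a) (λ v → 𝟙-conj v i k)))

    #₂-invariant : ∀ {i j k l i′ j′ k′ l′} → t i ≡ i′ → t j ≡ j′ → t k ≡ k′ → t l ≡ l′ →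
                   #[ i ↦ k , j ↦ l ] ≡ #[ i′ ↦ k′ , j′ ↦ l′ ]
    #₂-invariant {i} {j} {k} {l} refl refl refl refl = sym (trans
      (sym (∑-Class-conj t t-involutive (λ v → 𝟙[ lookup v (t i) Finₚ.≟ t k ] * 𝟙[ lookup v (t j) Finₚ.≟ t l ])))
      (∑-cong (Class n a) (λ v → cong₂ _*_ (𝟙-conj v i k) (𝟙-conj v j l))))

    #²-invariant : ∀ {i k i′ k′} → t i ≡ i′ → t k ≡ k′ → #[ i ↦² k ] ≡ #[ i′ ↦² k′ ]
    #²-invariant {i} {k} refl refl = sym (trans
      (sym (∑-Class-conj t t-involutive (λ v → 𝟙[ lookup v (lookup v (t i)) Finₚ.≟ t k ])))
      (∑-cong (Class n a) (λ v → trans (cong (λ x → 𝟙[ lookup (conj t v) x Finₚ.≟ t k ]) (lookup-conj v i))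
                                       (𝟙-conj v (lookup v i) k))))

  #-diagonal : ∀ i k → #[ i ↦ k , i ↦ k ] ≡ #[ i ↦ k ]
  #-diagonal i k = ∑-cong (Class n a) (λ v → 𝟙-idem (lookup v i Finₚ.≟ k))

  #-comm : ∀ i k j l → #[ i ↦ k , j ↦ l ] ≡ #[ j ↦ l , i ↦ k ]
  #-comm i k j l = ∑-cong (Class n a) (λ v → ℕₚ.*-comm 𝟙[ lookup v i Finₚ.≟ k ] 𝟙[ lookup v j Finₚ.≟ l ])

  #-collision : ∀ {i j} k → i ≢ j → #[ i ↦ k , j ↦ k ] ≡ 0
  #-collision {i} {j} k i≢j = ∑-Class-const never
    where
    never : ∀ v → IsPerm v → cycleType v ≡ a → 𝟙[ lookup v i Finₚ.≟ k ] * 𝟙[ lookup v j Finₚ.≟ k ] ≡ 0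
    never v v-inj _ with lookup v i Finₚ.≟ k | lookup v j Finₚ.≟ k
    ... | yes vi≡k | yes vj≡k = ⊥-elim (i≢j (v-inj i j (trans vi≡k (sym vj≡k))))
    ... | yes _    | no _     = refl
    ... | no _     | _        = refl

  ∑-#₁ : ∀ i → ∑[ k ∈ allFin n ] #[ i ↦ k ] ≡ ∣C∣
  ∑-#₁ i = begin
    ∑[ k ∈ allFin n ] #[ i ↦ k ]                                   ≡⟨ ∑-comm (allFin n) (Class n a) _ ⟩
    ∑[ v ∈ Class n a ] ∑[ k ∈ allFin n ] 𝟙[ lookup v i Finₚ.≟ k ]  ≡⟨ ∑-Class-const (λ v _ _ → AllFin.occurs-once (lookup v i)) ⟩
    1 * ∣C∣                                                        ≡⟨ ℕₚ.*-identityˡ ∣C∣ ⟩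
    ∣C∣                                                            ∎
    where open ≡-Reasoning

  ∑-#₂ : ∀ i k j → ∑[ l ∈ allFin n ] #[ i ↦ k , j ↦ l ] ≡ #[ i ↦ k ]
  ∑-#₂ i k j = begin
    ∑[ l ∈ allFin n ] #[ i ↦ k , j ↦ l ]
      ≡⟨ ∑-comm (allFin n) (Class n a) _ ⟩
    ∑[ v ∈ Class n a ] ∑[ l ∈ allFin n ] (𝟙[ lookup v i Finₚ.≟ k ] * 𝟙[ lookup v j Finₚ.≟ l ])
      ≡⟨ ∑-cong (Class n a) (λ v → ∑-*ˡ (allFin n) 𝟙[ lookup v i Finₚ.≟ k ] (λ l → 𝟙[ lookup v j Finₚ.≟ l ])) ⟩
    ∑[ v ∈ Class n a ] (𝟙[ lookup v i Finₚ.≟ k ] * ∑[ l ∈ allFin n ] 𝟙[ lookup v j Finₚ.≟ l ])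
      ≡⟨ ∑-cong (Class n a) (λ v → cong (𝟙[ lookup v i Finₚ.≟ k ] *_) (AllFin.occurs-once (lookup v j))) ⟩
    ∑[ v ∈ Class n a ] (𝟙[ lookup v i Finₚ.≟ k ] * 1)
      ≡⟨ ∑-cong (Class n a) (λ v → ℕₚ.*-identityʳ 𝟙[ lookup v i Finₚ.≟ k ]) ⟩
    #[ i ↦ k ] ∎
    where open ≡-Reasoning

  ∑-#-through : ∀ i k → ∑[ y ∈ allFin n ] #[ i ↦ y , y ↦ k ] ≡ #[ i ↦² k ]
  ∑-#-through i k = trans (∑-comm (allFin n) (Class n a) _)
    (∑-cong (Class n a) (λ v → AllFin.∑-sift′ (lookup v i) (λ y → 𝟙[ lookup v y Finₚ.≟ k ])))

  module _ {α} (fixedPoints≡α : ∀ v → IsPerm v → cycleType v ≡ a → fixedPoints v ≡ α) where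

    ∑-#fixed : ∑[ i ∈ allFin n ] #[ i ↦ i ] ≡ α * ∣C∣
    ∑-#fixed = trans (∑-comm (allFin n) (Class n a) _) (∑-Class-const fixedPoints≡α)

    ∑-#fixed-fixed : ∀ i → ∑[ j ∈ allFin n ] #[ i ↦ i , j ↦ j ] ≡ α * #[ i ↦ i ]
    ∑-#fixed-fixed i = begin
      ∑[ j ∈ allFin n ] #[ i ↦ i , j ↦ j ]
        ≡⟨ ∑-comm (allFin n) (Class n a) _ ⟩
      ∑[ v ∈ Class n a ] ∑[ j ∈ allFin n ] (𝟙[ lookup v i Finₚ.≟ i ] * 𝟙[ lookup v j Finₚ.≟ j ])
        ≡⟨ ∑-cong (Class n a) (λ v → ∑-*ˡ (allFin n) 𝟙[ lookup v i Finₚ.≟ i ] (λ j → 𝟙[ lookup v j Finₚ.≟ j ])) ⟩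
      ∑[ v ∈ Class n a ] (𝟙[ lookup v i Finₚ.≟ i ] * fixedPoints v)
        ≡⟨ ∑-Class-cong (λ v v-perm v-type → trans (cong (𝟙[ lookup v i Finₚ.≟ i ] *_) (fixedPoints≡α v v-perm v-type))
                                                   (ℕₚ.*-comm 𝟙[ lookup v i Finₚ.≟ i ] α)) ⟩
      ∑[ v ∈ Class n a ] (α * 𝟙[ lookup v i Finₚ.≟ i ])
        ≡⟨ ∑-*ˡ (Class n a) α (λ v → 𝟙[ lookup v i Finₚ.≟ i ]) ⟩
      α * #[ i ↦ i ] ∎
      where open ≡-Reasoning

  ∑-#squareFixed : ∀ {β} → (∀ v → IsPerm v → cycleType v ≡ a → squareFixedPoints v ≡ β) →
                   ∑[ i ∈ allFin n ] #[ i ↦² i ] ≡ β * ∣C∣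
  ∑-#squareFixed squareFixedPoints≡β = trans (∑-comm (allFin n) (Class n a) _) (∑-Class-const squareFixedPoints≡β)

  module Outside {zs : List (Fin n)} {y l : Fin n} (y∉zs : y ∉ zs) (l∉zs : l ∉ zs) where

    open Invariance (PC.transpose y l) (transpose-involutive y l)

    private
      fixes : ∀ {z} → z ∈ zs → PC.transpose y l z ≡ z
      fixes = transpose-outside y∉zs l∉zs

      moves : PC.transpose y l y ≡ l
      moves = transpose-matchˡ y l

    #fixed-outside : #[ y ↦ y ] ≡ #[ l ↦ l ]
    #fixed-outside = #₁-invariant moves moves

    #squareFixed-outside : #[ y ↦² y ] ≡ #[ l ↦² l ]
    #squareFixed-outside = #²-invariant moves moves

    #₁-outside : ∀ {i} → i ∈ zs → #[ i ↦ y ] ≡ #[ i ↦ l ]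
    #₁-outside i∈zs = #₁-invariant (fixes i∈zs) moves

    #fixed-fixed-outside : ∀ {i} → i ∈ zs → #[ i ↦ i , y ↦ y ] ≡ #[ i ↦ i , l ↦ l ]
    #fixed-fixed-outside i∈zs = #₂-invariant (fixes i∈zs) moves (fixes i∈zs) moves

    #swapped-outside : ∀ {i} → i ∈ zs → #[ i ↦ y , y ↦ i ] ≡ #[ i ↦ l , l ↦ i ]
    #swapped-outside i∈zs = #₂-invariant (fixes i∈zs) moves moves (fixes i∈zs)

    #₂-outside : ∀ {i j k} → i ∈ zs → j ∈ zs → k ∈ zs → #[ i ↦ k , j ↦ y ] ≡ #[ i ↦ k , j ↦ l ]
    #₂-outside i∈zs j∈zs k∈zs = #₂-invariant (fixes i∈zs) (fixes j∈zs) (fixes k∈zs) moves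


  #inversions : Fin n → Fin n → ℕ
  #inversions i j = ∑[ v ∈ Class n a ] 𝟙[ (i <? j) ×-dec (lookup v j <? lookup v i) ]

  #inversions≡∑#₂ : ∀ i j → #inversions i j ≡
    ∑[ k ∈ allFin n ] ∑[ l ∈ allFin n ] (𝟙[ (i <? j) ×-dec (l <? k) ] * #[ i ↦ k , j ↦ l ])
  #inversions≡∑#₂ i j = begin
    #inversions i j
      ≡⟨ ∑-cong (Class n a) (λ v → sym (sift₂ v)) ⟩
    ∑[ v ∈ Class n a ] ∑[ k ∈ allFin n ] ∑[ l ∈ allFin n ] (inv k l * (𝟙[ lookup v i Finₚ.≟ k ] * 𝟙[ lookup v j Finₚ.≟ l ]))
      ≡⟨ ∑-comm (Class n a) (allFin n) _ ⟩
    ∑[ k ∈ allFin n ] ∑[ v ∈ Class n a ] ∑[ l ∈ allFin n ] (inv k l * (𝟙[ lookup v i Finₚ.≟ k ] * 𝟙[ lookup v j Finₚ.≟ l ]))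
      ≡⟨ ∑-cong (allFin n) (λ k → ∑-comm (Class n a) (allFin n) _) ⟩
    ∑[ k ∈ allFin n ] ∑[ l ∈ allFin n ] ∑[ v ∈ Class n a ] (inv k l * (𝟙[ lookup v i Finₚ.≟ k ] * 𝟙[ lookup v j Finₚ.≟ l ]))
      ≡⟨ ∑-cong (allFin n) (λ k → ∑-cong (allFin n) (λ l → ∑-*ˡ (Class n a) (inv k l) _)) ⟩
    ∑[ k ∈ allFin n ] ∑[ l ∈ allFin n ] (inv k l * #[ i ↦ k , j ↦ l ]) ∎
    where
    open ≡-Reasoning
    inv : Fin n → Fin n → ℕ
    inv k l = 𝟙[ (i <? j) ×-dec (l <? k) ]
    sift₂ : ∀ v → ∑[ k ∈ allFin n ] ∑[ l ∈ allFin n ] (inv k l * (𝟙[ lookup v i Finₚ.≟ k ] * 𝟙[ lookup v j Finₚ.≟ l ]))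
                ≡ inv (lookup v i) (lookup v j)
    sift₂ v = begin
      ∑[ k ∈ allFin n ] ∑[ l ∈ allFin n ] (inv k l * (𝟙[ lookup v i Finₚ.≟ k ] * 𝟙[ lookup v j Finₚ.≟ l ]))
        ≡⟨ ∑-cong (allFin n) (λ k → ∑-cong (allFin n) (λ l → rotate (inv k l) 𝟙[ lookup v i Finₚ.≟ k ] 𝟙[ lookup v j Finₚ.≟ l ])) ⟩
      ∑[ k ∈ allFin n ] ∑[ l ∈ allFin n ] (𝟙[ lookup v i Finₚ.≟ k ] * (𝟙[ lookup v j Finₚ.≟ l ] * inv k l))
        ≡⟨ ∑-cong (allFin n) (λ k → ∑-*ˡ (allFin n) 𝟙[ lookup v i Finₚ.≟ k ] _) ⟩
      ∑[ k ∈ allFin n ] (𝟙[ lookup v i Finₚ.≟ k ] * ∑[ l ∈ allFin n ] (𝟙[ lookup v j Finₚ.≟ l ] * inv k l))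
        ≡⟨ ∑-cong (allFin n) (λ k → cong (𝟙[ lookup v i Finₚ.≟ k ] *_) (AllFin.∑-sift′ (lookup v j) (inv k))) ⟩
      ∑[ k ∈ allFin n ] (𝟙[ lookup v i Finₚ.≟ k ] * inv k (lookup v j))
        ≡⟨ AllFin.∑-sift′ (lookup v i) (λ k → inv k (lookup v j)) ⟩
      inv (lookup v i) (lookup v j) ∎
      where
      rotate : ∀ x y z → x * (y * z) ≡ y * (z * x)
      rotate x y z = trans (ℕₚ.*-comm x (y * z)) (ℕₚ.*-assoc y z x)

  ∑-invStat : ∀ wt → ℚSum.∑ (Class n a) (invStat wt) ≡
              ℚSum.∑ (allFin n) (λ i → ℚSum.∑ (allFin n) (λ j → #inversions i j · wt i j))
  ∑-invStat wt = begin
    ℚSum.∑ (Class n a) (invStat wt)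
      ≡⟨ ℚSum.∑-cong (Class n a) invStat-as-∑ ⟩
    ℚSum.∑ (Class n a) (λ v → ℚSum.∑ (allFin n) (λ i → ℚSum.∑ (allFin n) (λ j → term i j v)))
      ≡⟨ ℚSum.∑-comm (Class n a) (allFin n) _ ⟩
    ℚSum.∑ (allFin n) (λ i → ℚSum.∑ (Class n a) (λ v → ℚSum.∑ (allFin n) (λ j → term i j v)))
      ≡⟨ ℚSum.∑-cong (allFin n) (λ i → ℚSum.∑-comm (Class n a) (allFin n) _) ⟩
    ℚSum.∑ (allFin n) (λ i → ℚSum.∑ (allFin n) (λ j → ℚSum.∑ (Class n a) (term i j)))
      ≡⟨ ℚSum.∑-cong (allFin n) (λ i → ℚSum.∑-cong (allFin n) (λ j → trans
           (ℚSum.∑-cong (Class n a) (λ v → term≡𝟙· i j v)) (sym (ℚSum.∑ℕ-× (Class n a) _ (wt i j))))) ⟩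
    ℚSum.∑ (allFin n) (λ i → ℚSum.∑ (allFin n) (λ j → #inversions i j · wt i j)) ∎
    where
    open ≡-Reasoning
    term : Fin n → Fin n → Vec (Fin n) n → ℚ
    term i j v = if does ((i <? j) ×-dec (lookup v j <? lookup v i)) then wt i j else 0ℚ
    invStat-as-∑ : ∀ v → invStat wt v ≡ ℚSum.∑ (allFin n) (λ i → ℚSum.∑ (allFin n) (λ j → term i j v))
    invStat-as-∑ v = begin
      invStat wt v
        ≡⟨ cong (foldr ℚ._+_ 0ℚ) (Listₚ.map-id (concatMap (λ i → map (λ j → term i j v) (allFin n)) (allFin n))) ⟨
      ℚSum.∑ (concatMap (λ i → map (λ j → term i j v) (allFin n)) (allFin n)) id
        ≡⟨ ℚSum.∑-concatMap (λ i → map (λ j → term i j v) (allFin n)) (allFin n) id ⟩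
      ℚSum.∑ (allFin n) (λ i → ℚSum.∑ (map (λ j → term i j v) (allFin n)) id)
        ≡⟨ ℚSum.∑-cong (allFin n) (λ i → ℚSum.∑-map (λ j → term i j v) (allFin n) id) ⟩
      ℚSum.∑ (allFin n) (λ i → ℚSum.∑ (allFin n) (λ j → term i j v)) ∎
    term≡𝟙· : ∀ i j v → term i j v ≡ 𝟙[ (i <? j) ×-dec (lookup v j <? lookup v i) ] · wt i j
    term≡𝟙· i j v with does ((i <? j) ×-dec (lookup v j <? lookup v i))
    ... | true  = sym (ℚₚ.+-identityʳ (wt i j))
    ... | false = refl

  expect≡ : ∀ wt .{{_ : ℕ.NonZero ∣C∣}} → expect n a wt ≡
            ℚSum.∑ (allFin n) (λ i → ℚSum.∑ (allFin n) (λ j → (#inversions i j · wt i j) ℚ.* ((ℤ.+ 1) ℚ./ ∣C∣)))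
  expect≡ wt = begin
    expect n a wt
      ≡⟨ average-map (invStat wt) (Class n a) ⟩
    ℚSum.∑ (Class n a) (invStat wt) ℚ.* q
      ≡⟨ cong (ℚ._* q) (∑-invStat wt) ⟩
    ℚSum.∑ (allFin n) (λ i → ℚSum.∑ (allFin n) (λ j → #inversions i j · wt i j)) ℚ.* q
      ≡⟨ ℚSum.∑-*ʳ (allFin n) q _ ⟨
    ℚSum.∑ (allFin n) (λ i → ℚSum.∑ (allFin n) (λ j → #inversions i j · wt i j) ℚ.* q)
      ≡⟨ ℚSum.∑-cong (allFin n) (λ i → ℚSum.∑-*ʳ (allFin n) q _) ⟨
    ℚSum.∑ (allFin n) (λ i → ℚSum.∑ (allFin n) (λ j → (#inversions i j · wt i j) ℚ.* q)) ∎
    where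
    open ≡-Reasoning
    q : ℚ
    q = (ℤ.+ 1) ℚ./ ∣C∣

module TwoClasses (n : ℕ) (a b : Vec ℕ n) {α β : ℕ}
  (fixedPointsᴬ : ∀ v → IsPerm v → cycleType v ≡ a → fixedPoints v ≡ α)
  (fixedPointsᴮ : ∀ v → IsPerm v → cycleType v ≡ b → fixedPoints v ≡ α)
  (squareFixedPointsᴬ : ∀ v → IsPerm v → cycleType v ≡ a → squareFixedPoints v ≡ β)
  (squareFixedPointsᴮ : ∀ v → IsPerm v → cycleType v ≡ b → squareFixedPoints v ≡ β) where

  module A = ConjugacyClass n a
  module B = ConjugacyClass n b
  open Proportion A.∣C∣ B.∣C∣ public

  private
    ∉-from : ∀ {l} {zs : List (Fin n)} → All (l ≢_) zs → l ∉ zs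
    ∉-from = All¬⇒¬Any

    ∼-#collision : ∀ {i j} k → i ≢ j → A.#[ i ↦ k , j ↦ k ] ∼ B.#[ i ↦ k , j ↦ k ]
    ∼-#collision k i≢j = ∼-subst (sym (A.#-collision k i≢j)) (sym (B.#-collision k i≢j)) (cross refl)

    ∼-#-comm : ∀ {i j k l} → A.#[ j ↦ l , i ↦ k ] ∼ B.#[ j ↦ l , i ↦ k ] → A.#[ i ↦ k , j ↦ l ] ∼ B.#[ i ↦ k , j ↦ l ]
    ∼-#-comm {i} {j} {k} {l} = ∼-subst (A.#-comm j l i k) (B.#-comm j l i k)

  ∼-#fixed : ∀ i → A.#[ i ↦ i ] ∼ B.#[ i ↦ i ]
  ∼-#fixed i = ∼-by-split [] (λ ())
    (λ y y∉ → A.Outside.#fixed-outside y∉ (λ ())) (λ y y∉ → B.Outside.#fixed-outside y∉ (λ ()))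
    (A.∑-#fixed fixedPointsᴬ) (B.∑-#fixed fixedPointsᴮ) (∼-unit α) []

  ∼-#squareFixed : ∀ i → A.#[ i ↦² i ] ∼ B.#[ i ↦² i ]
  ∼-#squareFixed i = ∼-by-split [] (λ ())
    (λ y y∉ → A.Outside.#squareFixed-outside y∉ (λ ())) (λ y y∉ → B.Outside.#squareFixed-outside y∉ (λ ()))
    (A.∑-#squareFixed squareFixedPointsᴬ) (B.∑-#squareFixed squareFixedPointsᴮ) (∼-unit β) []

  module _ {i j : Fin n} (j≢i : j ≢ i) where

    private
      j∉[i] : j ∉ i ∷ []
      j∉[i] = ∉-from (j≢i ∷ [])

    ∼-#moved : A.#[ i ↦ j ] ∼ B.#[ i ↦ j ]
    ∼-#moved = ∼-by-split ([] ∷ []) j∉[i]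
      (λ y y∉ → A.Outside.#₁-outside y∉ j∉[i] (here refl)) (λ y y∉ → B.Outside.#₁-outside y∉ j∉[i] (here refl))
      (A.∑-#₁ i) (B.∑-#₁ i) ∼-size (∼-#fixed i ∷ [])

    ∼-#fixed-fixed : A.#[ i ↦ i , j ↦ j ] ∼ B.#[ i ↦ i , j ↦ j ]
    ∼-#fixed-fixed = ∼-by-split ([] ∷ []) j∉[i]
      (λ y y∉ → A.Outside.#fixed-fixed-outside y∉ j∉[i] (here refl))
      (λ y y∉ → B.Outside.#fixed-fixed-outside y∉ j∉[i] (here refl))
      (A.∑-#fixed-fixed fixedPointsᴬ i) (B.∑-#fixed-fixed fixedPointsᴮ i) (∼-*ˡ α (∼-#fixed i))
      (∼-subst (sym (A.#-diagonal i i)) (sym (B.#-diagonal i i)) (∼-#fixed i) ∷ [])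

    ∼-#swapped : A.#[ i ↦ j , j ↦ i ] ∼ B.#[ i ↦ j , j ↦ i ]
    ∼-#swapped = ∼-by-split ([] ∷ []) j∉[i]
      (λ y y∉ → A.Outside.#swapped-outside y∉ j∉[i] (here refl))
      (λ y y∉ → B.Outside.#swapped-outside y∉ j∉[i] (here refl))
      (A.∑-#-through i i) (B.∑-#-through i i) (∼-#squareFixed i)
      (∼-subst (sym (A.#-diagonal i i)) (sym (B.#-diagonal i i)) (∼-#fixed i) ∷ [])

    module _ {l : Fin n} (l≢i : l ≢ i) (l≢j : l ≢ j) where

      private
        l∉[j,i] : l ∉ j ∷ i ∷ []
        l∉[j,i] = ∉-from (l≢j ∷ l≢i ∷ [])

        [j,i]-unique : Unique (j ∷ i ∷ [])
        [j,i]-unique = (j≢i ∷ []) ∷ [] ∷ []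

        i∈ : i ∈ j ∷ i ∷ []
        i∈ = there (here refl)

        j∈ : j ∈ j ∷ i ∷ []
        j∈ = here refl

      ∼-#fixed-moved : A.#[ i ↦ i , j ↦ l ] ∼ B.#[ i ↦ i , j ↦ l ]
      ∼-#fixed-moved = ∼-by-split [j,i]-unique l∉[j,i]
        (λ y y∉ → A.Outside.#₂-outside y∉ l∉[j,i] i∈ j∈ i∈)
        (λ y y∉ → B.Outside.#₂-outside y∉ l∉[j,i] i∈ j∈ i∈)
        (A.∑-#₂ i i j) (B.∑-#₂ i i j) (∼-#fixed i)
        (∼-#fixed-fixed ∷ ∼-#collision i (j≢i ∘ sym) ∷ [])

      ∼-#chain : A.#[ i ↦ j , j ↦ l ] ∼ B.#[ i ↦ j , j ↦ l ]
      ∼-#chain = ∼-by-split [j,i]-unique l∉[j,i]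
        (λ y y∉ → A.Outside.#₂-outside y∉ l∉[j,i] i∈ j∈ j∈)
        (λ y y∉ → B.Outside.#₂-outside y∉ l∉[j,i] i∈ j∈ j∈)
        (A.∑-#₂ i j j) (B.∑-#₂ i j j) ∼-#moved
        (∼-#collision j (j≢i ∘ sym) ∷ ∼-#swapped ∷ [])

  ∼-#disjoint : ∀ {i j k l} → j ≢ i → k ≢ i → k ≢ j → l ≢ i → l ≢ j → l ≢ k →
                A.#[ i ↦ k , j ↦ l ] ∼ B.#[ i ↦ k , j ↦ l ]
  ∼-#disjoint {i} {j} {k} {l} j≢i k≢i k≢j l≢i l≢j l≢k = ∼-by-split
    ((k≢j ∷ k≢i ∷ []) ∷ (j≢i ∷ []) ∷ [] ∷ []) l∉[k,j,i]
    (λ y y∉ → A.Outside.#₂-outside y∉ l∉[k,j,i] i∈ j∈ k∈)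
    (λ y y∉ → B.Outside.#₂-outside y∉ l∉[k,j,i] i∈ j∈ k∈)
    (A.∑-#₂ i k j) (B.∑-#₂ i k j) (∼-#moved k≢i)
    (∼-#collision k (j≢i ∘ sym) ∷ ∼-#-comm (∼-#fixed-moved i≢j k≢j k≢i) ∷ ∼-#-comm (∼-#chain i≢j k≢j k≢i) ∷ [])
    where
    i≢j : i ≢ j
    i≢j = j≢i ∘ sym
    l∉[k,j,i] : l ∉ k ∷ j ∷ i ∷ []
    l∉[k,j,i] = ∉-from (l≢k ∷ l≢j ∷ l≢i ∷ [])
    i∈ : i ∈ k ∷ j ∷ i ∷ []
    i∈ = there (there (here refl))
    j∈ : j ∈ k ∷ j ∷ i ∷ []
    j∈ = there (here refl)
    k∈ : k ∈ k ∷ j ∷ i ∷ []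
    k∈ = here refl

  ∼-#₂ : ∀ {i j} k l → i ≢ j → A.#[ i ↦ k , j ↦ l ] ∼ B.#[ i ↦ k , j ↦ l ]
  ∼-#₂ {i} {j} k l i≢j with k Finₚ.≟ l
  ... | yes refl = ∼-#collision k i≢j
  ... | no k≢l with k Finₚ.≟ i | k Finₚ.≟ j | l Finₚ.≟ i | l Finₚ.≟ j
  ...   | yes refl | _        | _        | yes refl = ∼-#fixed-fixed (i≢j ∘ sym)
  ...   | yes refl | _        | _        | no l≢j   = ∼-#fixed-moved (i≢j ∘ sym) (k≢l ∘ sym) l≢j
  ...   | no _     | yes refl | yes refl | _        = ∼-#swapped (i≢j ∘ sym)
  ...   | no _     | yes refl | no l≢i   | _        = ∼-#chain (i≢j ∘ sym) l≢i (k≢l ∘ sym)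
  ...   | no k≢i   | no k≢j   | yes refl | _        = ∼-#-comm (∼-#chain i≢j k≢j k≢i)
  ...   | no k≢i   | no k≢j   | no _     | yes refl = ∼-#-comm (∼-#fixed-moved i≢j k≢j k≢i)
  ...   | no k≢i   | no k≢j   | no l≢i   | no l≢j   = ∼-#disjoint (i≢j ∘ sym) k≢i k≢j l≢i l≢j (k≢l ∘ sym)

  ∼-#inversions : ∀ i j → A.#inversions i j ∼ B.#inversions i j
  ∼-#inversions i j = ∼-subst (sym (A.#inversions≡∑#₂ i j)) (sym (B.#inversions≡∑#₂ i j))
    (∼-∑ (allFin n) (λ k → ∼-∑ (allFin n) (λ l → term k l)))
    where
    term : ∀ k l → 𝟙[ (i <? j) ×-dec (l <? k) ] * A.#[ i ↦ k , j ↦ l ] ∼ 𝟙[ (i <? j) ×-dec (l <? k) ] * B.#[ i ↦ k , j ↦ l ]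
    term k l with i Finₚ.≟ j
    ... | yes refl rewrite 𝟙-no ((i <? i) ×-dec (l <? k)) (Finₚ.<-irrefl refl ∘ proj₁) = cross refl
    ... | no i≢j = ∼-*ˡ 𝟙[ (i <? j) ×-dec (l <? k) ] (∼-#₂ k l i≢j)

  expect-≡ : .{{_ : ℕ.NonZero A.∣C∣}} .{{_ : ℕ.NonZero B.∣C∣}} → ∀ wt → expect n a wt ≡ expect n b wt
  expect-≡ wt = begin
    expect n a wt
      ≡⟨ A.expect≡ wt ⟩
    ℚSum.∑ (allFin n) (λ i → ℚSum.∑ (allFin n) (λ j → (A.#inversions i j · wt i j) ℚ.* ((ℤ.+ 1) ℚ./ A.∣C∣)))
      ≡⟨ ℚSum.∑-cong (allFin n) (λ i → ℚSum.∑-cong (allFin n) (λ j →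
           ×-ratio {m = A.#inversions i j} {B.#inversions i j} {A.∣C∣} {B.∣C∣} (wt i j)
                   (cross-≡ (∼-#inversions i j)) (·1ℚ-*-inverse A.∣C∣) (·1ℚ-*-inverse B.∣C∣))) ⟩
    ℚSum.∑ (allFin n) (λ i → ℚSum.∑ (allFin n) (λ j → (B.#inversions i j · wt i j) ℚ.* ((ℤ.+ 1) ℚ./ B.∣C∣)))
      ≡⟨ B.expect≡ wt ⟨
    expect n b wt ∎
    where open ≡-Reasoning

theorem1p1 : (n : ℕ) → 1 ≤ n → (wt : Fin n → Fin n → ℚ)
    → (a b : Vec ℕ n) → IsPartition n a → IsPartition n b
    → mult a 1 ≡ mult b 1 → mult a 2 ≡ mult b 2
    → expect n a wt ≡ expect n b wt
theorem1p1 (suc n) _ wt a b a⊢n b⊢n a₁≡b₁ a₂≡b₂ =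
  expect-≡ ⦃ ℕ.>-nonZero (A.1≤∣C∣ a⊢n) ⦄ ⦃ ℕ.>-nonZero (B.1≤∣C∣ b⊢n) ⦄ wt
  where
  open TwoClasses (suc n) a b
    (λ v _ → fixedPoints-of-type v)
    (λ v _ v-type → trans (fixedPoints-of-type v v-type) (sym a₁≡b₁))
    (λ v _ → squareFixedPoints-of-type v)
    (λ v _ v-type → trans (squareFixedPoints-of-type v v-type) (sym (cong₂ (λ m₁ m₂ → m₁ + 2 * m₂) a₁≡b₁ a₂≡b₂)))
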